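{- Let $n\ge 4$ and let $\mathbb{Z}^n\rtimes S_n$ be the semidirect product in which the symmetric group $S_n$ acts on $\mathbb{Z}^n$ by permuting coordinates. Then $\mathbb{Z}^n\rtimes S_n$ is isomorphic to the group with generators $\sigma,\tau,\gamma$ and defining relations $$\begin{cases}\sigma^2=e,\\ (\sigma\tau\sigma\tau^{ -1})^3=e,\\ (\sigma\tau^m\sigma\tau^{ -m})^2=e, & 2\le m\le n-2,\\ (\sigma\tau)^{n-1}=\tau^n,\\ \gamma\,\tau^k\sigma\tau^{ -k}=\tau^k\sigma\tau^{ -k}\,\gamma, & 0\le k\le n-3,\\ \gamma\,\tau^l\gamma\tau^{ -l}=\tau^l\gamma\tau^{ -l}\,\gamma, & 1\le l\le n-1.\end{cases}$$ -}

module Defs where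

open import Data.Nat using (ℕ; zero; suc; _≤_; _∸_)
open import Data.Integer using (ℤ) renaming (_+_ to _+ℤ_; -_ to -ℤ_)
open import Data.Fin using (Fin)
open import Data.Product using (_×_; _,_; proj₁; proj₂)
open import Data.Fin.Permutation as P using (Permutation′; _⟨$⟩ʳ_; _⟨$⟩ˡ_; _∘ₚ_)
open import Relation.Binary.PropositionalEquality using (_≡_)

SD : ℕ → Set
SD n = (Fin n → ℤ) × Permutation′ n

act : ∀ {n} → Permutation′ n → (Fin n → ℤ) → (Fin n → ℤ)
act π w i = w (π ⟨$⟩ˡ i)

-- function composition π ∘ ρ (stdlib's _∘ₚ_ is diagrammatic)
_∘S_ : ∀ {n} → Permutation′ n → Permutation′ n → Permutation′ n
π ∘S ρ = ρ ∘ₚ π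

_*SD_ : ∀ {n} → SD n → SD n → SD n
(v , π) *SD (w , ρ) = (λ i → v i +ℤ act π w i) , (π ∘S ρ)

_≈SD_ : ∀ {n} → SD n → SD n → Set
(v , π) ≈SD (w , ρ) = (∀ i → v i ≡ w i) × (π P.≈ ρ)

-- The finitely presented group ⟨σ, τ, γ | relations⟩, as the setoid of
-- group words modulo the congruence generated by the group axioms and
-- the defining relations (i.e. free group modulo normal closure).

data Gen : Set where
  σ τ γ : Gen

infixl 7 _·_
infix 8 _⁻¹

data Word : Set where
  gen  : Gen → Word
  e    : Word
  _·_  : Word → Word → Word
  _⁻¹  : Word → Word

pow : Word → ℕ → Word
pow w zero    = e
pow w (suc m) = w · pow w m

s t g : Word
s = gen σ
t = gen τ
g = gen γ

conjT : ℕ → Word → Word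
conjT k x = pow t k · x · (pow t k) ⁻¹

infix 4 _⊢_≈_

data _⊢_≈_ (n : ℕ) : Word → Word → Set where
  ≈-refl  : ∀ {a} → n ⊢ a ≈ a
  ≈-sym   : ∀ {a b} → n ⊢ a ≈ b → n ⊢ b ≈ a
  ≈-trans : ∀ {a b c} → n ⊢ a ≈ b → n ⊢ b ≈ c → n ⊢ a ≈ c
  ·-cong  : ∀ {a b c d} → n ⊢ a ≈ b → n ⊢ c ≈ d → n ⊢ a · c ≈ b · d
  ⁻¹-cong : ∀ {a b} → n ⊢ a ≈ b → n ⊢ a ⁻¹ ≈ b ⁻¹
  assoc   : ∀ a b c → n ⊢ (a · b) · c ≈ a · (b · c)
  idˡ     : ∀ a → n ⊢ e · a ≈ a
  idʳ     : ∀ a → n ⊢ a · e ≈ a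
  invˡ    : ∀ a → n ⊢ a ⁻¹ · a ≈ e
  invʳ    : ∀ a → n ⊢ a · a ⁻¹ ≈ e
  rel₁ : n ⊢ pow s 2 ≈ e
  rel₂ : n ⊢ pow (s · t · s · t ⁻¹) 3 ≈ e
  rel₃ : ∀ m → 2 ≤ m → m ≤ n ∸ 2 →
         n ⊢ pow (s · pow t m · s · (pow t m) ⁻¹) 2 ≈ e
  rel₄ : n ⊢ pow (s · t) (n ∸ 1) ≈ pow t n
  rel₅ : ∀ k → k ≤ n ∸ 3 → n ⊢ g · conjT k s ≈ conjT k s · g
  rel₆ : ∀ l → 1 ≤ l → l ≤ n ∸ 1 → n ⊢ g · conjT l g ≈ conjT l g · g

module Submission where

-- σ, τ, γ go to the transposition (0 1), the n-cycle i ↦ i + 1 and the unit vector at n - 1; these satisfy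
-- the relations, giving a homomorphism onto ℤⁿ ⋊ Sₙ, and the point is injectivity.  The conjugates
-- sᵢ = τⁱστ⁻ⁱ satisfy the Coxeter relations of Sₙ (relations 1-3), and τ = s₀s₁⋯sₙ₋₂ (relation 4).
-- Hence every permutation π has a normal word W π, a product of descending runs of sᵢ, and W π · sᵢ = W (π sᵢ).
-- Conjugating γ by W of a permutation taking n - 1 to x gives γₓ.  Relation 5 makes γ commute with W π
-- whenever π fixes n - 1, and then relation 6 makes the γₓ commute pairwise.  So every word equals
-- γ₀^v₀ ⋯ γₙ₋₁^vₙ₋₁ · W π, a word determined by its image (v, π).

open import Data.Nat using (ℕ; zero; suc; _+_; _∸_; _≤_; _<_; z≤n; s≤s)
import Data.Nat.Properties as ℕ
open import Data.Integer using (ℤ; +_; -[1+_]; 0ℤ; 1ℤ) renaming (_+_ to _+ℤ_; -_ to -ℤ_)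
import Data.Integer.Properties as ℤ
open import Data.Fin as F using (Fin; toℕ)
import Data.Fin.Properties as F
open import Data.Fin.Permutation as P using (Permutation′; _⟨$⟩ʳ_; _⟨$⟩ˡ_)
open import Data.Product using (Σ; _×_; ∃; _,_; proj₁; proj₂)
open import Data.Bool using (true; false; if_then_else_)
open import Data.Empty using (⊥-elim)
open import Function using (_∘_)
open import Relation.Nullary using (Dec; yes; no; does)
open import Relation.Nullary.Decidable using (dec-true; dec-false)
open import Relation.Binary.Definitions using (tri<; tri≈; tri>)
open import Relation.Binary.PropositionalEquality as ≡ using (_≡_; _≢_; refl)
open import Algebra.Bundles using (Group)
open import Tactic.MonoidSolver using (solve)

module GroupProperties {c ℓ} (G : Group c ℓ) where

  open Group G renaming (refl to ≈-refl)
  open import Relation.Binary.Reasoning.Setoid setoid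
  open import Algebra.Properties.Group G using (⁻¹-anti-homo-∙; ε⁻¹≈ε)

  infixr 8 _^_

  _^_ : Carrier → ℕ → Carrier
  x ^ zero = ε
  x ^ suc m = x ∙ x ^ m

  ^-+ : ∀ x m k → x ^ (m + k) ≈ x ^ m ∙ x ^ k
  ^-+ x zero k = sym (identityˡ _)
  ^-+ x (suc m) k = trans (∙-congˡ (^-+ x m k)) (sym (assoc _ _ _))

  ^-congˡ : ∀ {x y} m → x ≈ y → x ^ m ≈ y ^ m
  ^-congˡ zero x≈y = ≈-refl
  ^-congˡ (suc m) x≈y = ∙-cong x≈y (^-congˡ m x≈y)

  ^-sucʳ : ∀ x m → x ^ suc m ≈ x ^ m ∙ x
  ^-sucʳ x m = begin
    x ^ suc m      ≡⟨ ≡.cong (x ^_) (ℕ.+-comm 1 m) ⟩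
    x ^ (m + 1)    ≈⟨ ^-+ x m 1 ⟩
    x ^ m ∙ (x ∙ ε) ≈⟨ ∙-congˡ (identityʳ x) ⟩
    x ^ m ∙ x      ∎

  _^ℤ_ : Carrier → ℤ → Carrier
  x ^ℤ (+ m) = x ^ m
  x ^ℤ -[1+ m ] = (x ⁻¹) ^ suc m

  ^ℤ-sucʳ : ∀ x z → x ^ℤ z ∙ x ≈ x ^ℤ (z +ℤ 1ℤ)
  ^ℤ-sucʳ x (+ m) = trans (sym (^-sucʳ x m)) (reflexive (≡.cong (x ^_) (ℕ.+-comm 1 m)))
  ^ℤ-sucʳ x -[1+ zero ] = trans (∙-congʳ (identityʳ _)) (inverseˡ x)
  ^ℤ-sucʳ x -[1+ suc m ] = begin
    (x ⁻¹) ^ suc (suc m) ∙ x       ≈⟨ ∙-congʳ (^-sucʳ (x ⁻¹) (suc m)) ⟩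
    ((x ⁻¹) ^ suc m ∙ x ⁻¹) ∙ x    ≈⟨ assoc _ _ _ ⟩
    (x ⁻¹) ^ suc m ∙ (x ⁻¹ ∙ x)    ≈⟨ ∙-congˡ (inverseˡ x) ⟩
    (x ⁻¹) ^ suc m ∙ ε             ≈⟨ identityʳ _ ⟩
    (x ⁻¹) ^ suc m                 ∎

  conj : Carrier → Carrier → Carrier
  conj p x = (p ∙ x) ∙ p ⁻¹

  conj-∙ : ∀ p x y → conj p (x ∙ y) ≈ conj p x ∙ conj p y
  conj-∙ p x y = begin
    (p ∙ (x ∙ y)) ∙ p ⁻¹                  ≈⟨ solve monoid ⟩
    (p ∙ x) ∙ (ε ∙ (y ∙ p ⁻¹))            ≈⟨ ∙-congˡ (∙-congʳ (sym (inverseˡ p))) ⟩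
    (p ∙ x) ∙ ((p ⁻¹ ∙ p) ∙ (y ∙ p ⁻¹))   ≈⟨ solve monoid ⟩
    ((p ∙ x) ∙ p ⁻¹) ∙ ((p ∙ y) ∙ p ⁻¹)   ∎

  conj-ε : ∀ p → conj p ε ≈ ε
  conj-ε p = trans (∙-congʳ (identityʳ p)) (inverseʳ p)

  conj-^ : ∀ p x m → conj p (x ^ m) ≈ conj p x ^ m
  conj-^ p x zero = conj-ε p
  conj-^ p x (suc m) = trans (conj-∙ p x (x ^ m)) (∙-congˡ (conj-^ p x m))

  conj-congʳ : ∀ p {x y} → x ≈ y → conj p x ≈ conj p y
  conj-congʳ p eq = ∙-congʳ (∙-congˡ eq)

  conj-congˡ : ∀ {p q} x → p ≈ q → conj p x ≈ conj q x
  conj-congˡ x eq = ∙-cong (∙-congʳ eq) (⁻¹-cong eq)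

  conj-identity : ∀ x → conj ε x ≈ x
  conj-identity x = trans (∙-cong (identityˡ x) ε⁻¹≈ε) (identityʳ x)

  conj-conj : ∀ p q x → conj p (conj q x) ≈ conj (p ∙ q) x
  conj-conj p q x = begin
    (p ∙ ((q ∙ x) ∙ q ⁻¹)) ∙ p ⁻¹     ≈⟨ solve monoid ⟩
    ((p ∙ q) ∙ x) ∙ (q ⁻¹ ∙ p ⁻¹)     ≈⟨ ∙-congˡ (sym (⁻¹-anti-homo-∙ p q)) ⟩
    ((p ∙ q) ∙ x) ∙ (p ∙ q) ⁻¹        ∎

  Commute : Carrier → Carrier → Set ℓ
  Commute x y = x ∙ y ≈ y ∙ x

  commute-ε : ∀ x → Commute x ε
  commute-ε x = trans (identityʳ x) (sym (identityˡ x))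

  commute-∙ : ∀ {x a b} → Commute x a → Commute x b → Commute x (a ∙ b)
  commute-∙ {x} {a} {b} xa xb = begin
    x ∙ (a ∙ b)   ≈⟨ sym (assoc _ _ _) ⟩
    (x ∙ a) ∙ b   ≈⟨ ∙-congʳ xa ⟩
    (a ∙ x) ∙ b   ≈⟨ assoc _ _ _ ⟩
    a ∙ (x ∙ b)   ≈⟨ ∙-congˡ xb ⟩
    a ∙ (b ∙ x)   ≈⟨ sym (assoc _ _ _) ⟩
    (a ∙ b) ∙ x   ∎

  commute-^ : ∀ {x a} m → Commute x a → Commute x (a ^ m)
  commute-^ {x} zero xa = commute-ε x
  commute-^ (suc m) xa = commute-∙ xa (commute-^ m xa)

  commute-⁻¹ : ∀ {x a} → Commute x a → Commute x (a ⁻¹)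
  commute-⁻¹ {x} {a} xa = begin
    x ∙ a ⁻¹                     ≈⟨ solve monoid ⟩
    ε ∙ (x ∙ a ⁻¹)               ≈⟨ ∙-congʳ (sym (inverseˡ a)) ⟩
    (a ⁻¹ ∙ a) ∙ (x ∙ a ⁻¹)      ≈⟨ solve monoid ⟩
    a ⁻¹ ∙ ((a ∙ x) ∙ a ⁻¹)      ≈⟨ ∙-congˡ (∙-congʳ (sym xa)) ⟩
    a ⁻¹ ∙ ((x ∙ a) ∙ a ⁻¹)      ≈⟨ solve monoid ⟩
    (a ⁻¹ ∙ x) ∙ (a ∙ a ⁻¹)      ≈⟨ ∙-congˡ (inverseʳ a) ⟩
    (a ⁻¹ ∙ x) ∙ ε               ≈⟨ identityʳ _ ⟩
    a ⁻¹ ∙ x                     ∎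

  commute-^ℤ : ∀ {x a} z → Commute x a → Commute x (a ^ℤ z)
  commute-^ℤ (+ m) xa = commute-^ m xa
  commute-^ℤ -[1+ m ] xa = commute-^ (suc m) (commute-⁻¹ xa)

  commute⇒conj≈ : ∀ {x p} → Commute x p → conj p x ≈ x
  commute⇒conj≈ {x} {p} xp = begin
    (p ∙ x) ∙ p ⁻¹   ≈⟨ ∙-congʳ (sym xp) ⟩
    (x ∙ p) ∙ p ⁻¹   ≈⟨ assoc _ _ _ ⟩
    x ∙ (p ∙ p ⁻¹)   ≈⟨ ∙-congˡ (inverseʳ p) ⟩
    x ∙ ε            ≈⟨ identityʳ x ⟩
    x                ∎

  involutions-commute : ∀ {x y} → x ^ 2 ≈ ε → y ^ 2 ≈ ε → (x ∙ y) ^ 2 ≈ ε → Commute x y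
  involutions-commute {x} {y} xx yy xyxy = sym (begin
    y ∙ x                                         ≈⟨ sym (identityʳ _) ⟩
    (y ∙ x) ∙ ε                                   ≈⟨ ∙-congˡ (sym xyxy) ⟩
    (y ∙ x) ∙ ((x ∙ y) ∙ ((x ∙ y) ∙ ε))           ≈⟨ solve monoid ⟩
    (y ∙ (x ∙ (x ∙ ε))) ∙ (y ∙ (x ∙ y))           ≈⟨ ∙-congʳ (∙-congˡ xx) ⟩
    (y ∙ ε) ∙ (y ∙ (x ∙ y))                       ≈⟨ solve monoid ⟩
    (y ∙ (y ∙ ε)) ∙ (x ∙ y)                       ≈⟨ ∙-congʳ yy ⟩
    ε ∙ (x ∙ y)                                   ≈⟨ identityˡ _ ⟩
    x ∙ y                                         ∎)

  involutions-braid : ∀ {x y} → x ^ 2 ≈ ε → y ^ 2 ≈ ε → (x ∙ y) ^ 3 ≈ ε → (x ∙ y) ∙ x ≈ (y ∙ x) ∙ y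
  involutions-braid {x} {y} xx yy xy³ = begin
    (x ∙ y) ∙ x                                            ≈⟨ sym (identityʳ _) ⟩
    ((x ∙ y) ∙ x) ∙ ε                                      ≈⟨ ∙-congˡ (sym yxy²) ⟩
    ((x ∙ y) ∙ x) ∙ (((y ∙ x) ∙ y) ∙ ((y ∙ x) ∙ y))        ≈⟨ solve monoid ⟩
    ((x ∙ y) ∙ ((x ∙ y) ∙ ((x ∙ y) ∙ ε))) ∙ ((y ∙ x) ∙ y)  ≈⟨ ∙-congʳ xy³ ⟩
    ε ∙ ((y ∙ x) ∙ y)                                      ≈⟨ identityˡ _ ⟩
    (y ∙ x) ∙ y                                            ∎
    where
    yxy² : ((y ∙ x) ∙ y) ∙ ((y ∙ x) ∙ y) ≈ ε
    yxy² = begin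
      ((y ∙ x) ∙ y) ∙ ((y ∙ x) ∙ y)      ≈⟨ solve monoid ⟩
      (y ∙ x) ∙ ((y ∙ (y ∙ ε)) ∙ (x ∙ y)) ≈⟨ ∙-congˡ (∙-congʳ yy) ⟩
      (y ∙ x) ∙ (ε ∙ (x ∙ y))            ≈⟨ solve monoid ⟩
      y ∙ ((x ∙ (x ∙ ε)) ∙ y)            ≈⟨ ∙-congˡ (∙-congʳ xx) ⟩
      y ∙ (ε ∙ y)                        ≈⟨ solve monoid ⟩
      y ∙ (y ∙ ε)                        ≈⟨ yy ⟩
      ε                                  ∎

  conjProduct : Carrier → Carrier → ℕ → ℕ → Carrier
  conjProduct x y j zero = ε
  conjProduct x y j (suc m) = conj (y ^ j) x ∙ conjProduct x y (suc j) m

  conjProduct-suc : ∀ x y j m → conjProduct x y (suc j) m ≈ conj y (conjProduct x y j m)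
  conjProduct-suc x y j zero = sym (conj-ε y)
  conjProduct-suc x y j (suc m) =
    trans (∙-cong (sym (conj-conj y (y ^ j) x)) (conjProduct-suc x y (suc j) m))
          (sym (conj-∙ y _ _))

  ^-∙-conjProduct : ∀ x y m → (x ∙ y) ^ m ≈ conjProduct x y 0 m ∙ y ^ m
  ^-∙-conjProduct x y zero = sym (identityˡ ε)
  ^-∙-conjProduct x y (suc m) = begin
    (x ∙ y) ∙ (x ∙ y) ^ m                ≈⟨ ∙-congˡ (^-∙-conjProduct x y m) ⟩
    (x ∙ y) ∙ (A ∙ y ^ m)                ≈⟨ solve monoid ⟩
    (x ∙ (y ∙ A)) ∙ (ε ∙ y ^ m)          ≈⟨ ∙-congˡ (∙-congʳ (sym (inverseˡ y))) ⟩
    (x ∙ (y ∙ A)) ∙ ((y ⁻¹ ∙ y) ∙ y ^ m) ≈⟨ solve monoid ⟩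
    (x ∙ conj y A) ∙ (y ∙ y ^ m)         ≈⟨ ∙-congʳ (∙-cong (sym (conj-identity x)) (sym (conjProduct-suc x y 0 m))) ⟩
    (conj ε x ∙ conjProduct x y 1 m) ∙ (y ∙ y ^ m) ∎
    where
    A : Carrier
    A = conjProduct x y 0 m

-- ℕ → Fin (suc m), sending everything above m to m.
clamp : ∀ {m} → ℕ → Fin (suc m)
clamp {zero} _ = F.zero
clamp {suc m} zero = F.zero
clamp {suc m} (suc x) = F.suc (clamp x)

toℕ-clamp : ∀ {m} x → x ≤ m → toℕ (clamp {m} x) ≡ x
toℕ-clamp {zero} zero _ = refl
toℕ-clamp {suc m} zero _ = refl
toℕ-clamp {suc m} (suc x) (s≤s x≤m) = ≡.cong suc (toℕ-clamp x x≤m)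

clamp-toℕ : ∀ {m} (i : Fin (suc m)) → clamp (toℕ i) ≡ i
clamp-toℕ {zero} F.zero = refl
clamp-toℕ {suc m} F.zero = refl
clamp-toℕ {suc m} (F.suc i) = ≡.cong F.suc (clamp-toℕ i)

clamp-≢ : ∀ {m} x y → x ≤ m → y ≤ m → x ≢ y → clamp {m} x ≢ clamp y
clamp-≢ x y x≤m y≤m x≢y eq =
  x≢y (≡.trans (≡.sym (toℕ-clamp x x≤m)) (≡.trans (≡.cong toℕ eq) (toℕ-clamp y y≤m)))

module _ {m : ℕ} where

  open ≡ using (sym; trans; cong)

  transpose-applyˡ : ∀ (a b : Fin m) → P.transpose a b ⟨$⟩ʳ a ≡ b
  transpose-applyˡ a b rewrite dec-true (a F.≟ a) refl = refl

  -- Case splits on decisions go through local functions on Dec: a with-abstraction would also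
  -- abstract the decision inside transpose and leave the goal stuck.
  transpose-applyʳ : ∀ (a b : Fin m) → P.transpose a b ⟨$⟩ʳ b ≡ a
  transpose-applyʳ a b = by-cases (b F.≟ a)
    where
    by-cases : Dec (b ≡ a) → P.transpose a b ⟨$⟩ʳ b ≡ a
    by-cases (yes refl) = transpose-applyˡ b b
    by-cases (no b≢a) rewrite dec-false (b F.≟ a) b≢a | dec-true (b F.≟ b) refl = refl

  transpose-apply-≢ : ∀ {a b x : Fin m} → x ≢ a → x ≢ b → P.transpose a b ⟨$⟩ʳ x ≡ x
  transpose-apply-≢ {a} {b} {x} x≢a x≢b rewrite dec-false (x F.≟ a) x≢a | dec-false (x F.≟ b) x≢b = refl

  transpose-sym : ∀ (a b : Fin m) → P.transpose a b P.≈ P.transpose b a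
  transpose-sym a b x = by-cases (x F.≟ a) (x F.≟ b)
    where
    by-cases : Dec (x ≡ a) → Dec (x ≡ b) → P.transpose a b ⟨$⟩ʳ x ≡ P.transpose b a ⟨$⟩ʳ x
    by-cases (yes refl) (yes refl) = refl
    by-cases (yes refl) (no _) = trans (transpose-applyˡ x b) (sym (transpose-applyʳ b x))
    by-cases (no _) (yes refl) = trans (transpose-applyʳ a x) (sym (transpose-applyˡ x a))
    by-cases (no x≢a) (no x≢b) = trans (transpose-apply-≢ x≢a x≢b) (sym (transpose-apply-≢ x≢b x≢a))

  transpose-inverse : ∀ (a b x : Fin m) → P.transpose a b ⟨$⟩ˡ x ≡ P.transpose a b ⟨$⟩ʳ x
  transpose-inverse a b x = sym (transpose-sym a b x)

  transpose-involutive : ∀ (a b x : Fin m) → P.transpose a b ⟨$⟩ʳ (P.transpose a b ⟨$⟩ʳ x) ≡ x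
  transpose-involutive a b x =
    trans (cong (P.transpose a b ⟨$⟩ʳ_) (sym (transpose-inverse a b x))) (P.inverseʳ (P.transpose a b))

  ⟨$⟩ˡ-≢ : ∀ (π : Permutation′ m) {a x} → x ≢ π ⟨$⟩ʳ a → π ⟨$⟩ˡ x ≢ a
  ⟨$⟩ˡ-≢ π x≢πa eq = x≢πa (trans (sym (P.inverseʳ π)) (cong (π ⟨$⟩ʳ_) eq))

  transpose-conj : ∀ (π : Permutation′ m) (a b x : Fin m) →
    π ⟨$⟩ʳ (P.transpose a b ⟨$⟩ʳ (π ⟨$⟩ˡ x)) ≡ P.transpose (π ⟨$⟩ʳ a) (π ⟨$⟩ʳ b) ⟨$⟩ʳ x
  transpose-conj π a b x = by-cases (x F.≟ π ⟨$⟩ʳ a) (x F.≟ π ⟨$⟩ʳ b)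
    where
    by-cases : Dec (x ≡ π ⟨$⟩ʳ a) → Dec (x ≡ π ⟨$⟩ʳ b) →
      π ⟨$⟩ʳ (P.transpose a b ⟨$⟩ʳ (π ⟨$⟩ˡ x)) ≡ P.transpose (π ⟨$⟩ʳ a) (π ⟨$⟩ʳ b) ⟨$⟩ʳ x
    by-cases (yes refl) _ rewrite P.inverseˡ π {a} =
      trans (cong (π ⟨$⟩ʳ_) (transpose-applyˡ a b)) (sym (transpose-applyˡ (π ⟨$⟩ʳ a) (π ⟨$⟩ʳ b)))
    by-cases (no _) (yes refl) rewrite P.inverseˡ π {b} =
      trans (cong (π ⟨$⟩ʳ_) (transpose-applyʳ a b)) (sym (transpose-applyʳ (π ⟨$⟩ʳ a) (π ⟨$⟩ʳ b)))
    by-cases (no x≢πa) (no x≢πb) = trans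
      (cong (π ⟨$⟩ʳ_) (transpose-apply-≢ (⟨$⟩ˡ-≢ π x≢πa) (⟨$⟩ˡ-≢ π x≢πb)))
      (trans (P.inverseʳ π) (sym (transpose-apply-≢ x≢πa x≢πb)))

  transpose-disjoint-comm : ∀ {a b c d : Fin m} → a ≢ c → a ≢ d → b ≢ c → b ≢ d →
    ∀ x → P.transpose a b ⟨$⟩ʳ (P.transpose c d ⟨$⟩ʳ x) ≡ P.transpose c d ⟨$⟩ʳ (P.transpose a b ⟨$⟩ʳ x)
  transpose-disjoint-comm {a} {b} {c} {d} a≢c a≢d b≢c b≢d x = by-cases (x F.≟ a) (x F.≟ b) (x F.≟ c) (x F.≟ d)
    where
    T : Fin m → Fin m → Fin m → Fin m
    T u v z = P.transpose u v ⟨$⟩ʳ z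
    by-cases : Dec (x ≡ a) → Dec (x ≡ b) → Dec (x ≡ c) → Dec (x ≡ d) → T a b (T c d x) ≡ T c d (T a b x)
    by-cases (yes refl) _ _ _ = trans (cong (T a b) (transpose-apply-≢ a≢c a≢d))
      (trans (transpose-applyˡ a b) (sym (trans (cong (T c d) (transpose-applyˡ a b)) (transpose-apply-≢ b≢c b≢d))))
    by-cases (no _) (yes refl) _ _ = trans (cong (T a b) (transpose-apply-≢ b≢c b≢d))
      (trans (transpose-applyʳ a b) (sym (trans (cong (T c d) (transpose-applyʳ a b)) (transpose-apply-≢ a≢c a≢d))))
    by-cases (no x≢a) (no x≢b) (yes refl) _ = trans (cong (T a b) (transpose-applyˡ c d))
      (trans (transpose-apply-≢ (a≢d ∘ sym) (b≢d ∘ sym))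
             (sym (trans (cong (T c d) (transpose-apply-≢ x≢a x≢b)) (transpose-applyˡ c d))))
    by-cases (no x≢a) (no x≢b) (no _) (yes refl) = trans (cong (T a b) (transpose-applyʳ c d))
      (trans (transpose-apply-≢ (a≢c ∘ sym) (b≢c ∘ sym))
             (sym (trans (cong (T c d) (transpose-apply-≢ x≢a x≢b)) (transpose-applyʳ c d))))
    by-cases (no x≢a) (no x≢b) (no x≢c) (no x≢d) = trans (cong (T a b) (transpose-apply-≢ x≢c x≢d))
      (trans (transpose-apply-≢ x≢a x≢b) (sym (trans (cong (T c d) (transpose-apply-≢ x≢a x≢b)) (transpose-apply-≢ x≢c x≢d))))

  intertwine-inverse : ∀ (c a b : Permutation′ m) → (∀ y → c ⟨$⟩ʳ (a ⟨$⟩ʳ y) ≡ b ⟨$⟩ʳ (c ⟨$⟩ʳ y)) →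
    ∀ x → a ⟨$⟩ʳ (c ⟨$⟩ˡ x) ≡ c ⟨$⟩ˡ (b ⟨$⟩ʳ x)
  intertwine-inverse c a b ca≡bc x =
    trans (sym (P.inverseˡ c)) (cong (c ⟨$⟩ˡ_) (trans (ca≡bc (c ⟨$⟩ˡ x)) (cong (b ⟨$⟩ʳ_) (P.inverseʳ c))))

  single : Fin m → ℤ → Fin m → ℤ
  single x z i = if does (i F.≟ x) then z else 0ℤ

  single-≡ : ∀ x z → single x z x ≡ z
  single-≡ x z rewrite dec-true (x F.≟ x) refl = refl

  single-≢ : ∀ {x i} z → i ≢ x → single x z i ≡ 0ℤ
  single-≢ {x} {i} z i≢x rewrite dec-false (i F.≟ x) i≢x = refl

  single-+ : ∀ x z w i → single x z i +ℤ single x w i ≡ single x (z +ℤ w) i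
  single-+ x z w i with does (i F.≟ x)
  ... | true = refl
  ... | false = refl

  single-0 : ∀ x i → single x 0ℤ i ≡ 0ℤ
  single-0 x i with does (i F.≟ x)
  ... | true = refl
  ... | false = refl

  single-neg : ∀ x z i → -ℤ single x z i ≡ single x (-ℤ z) i
  single-neg x z i with does (i F.≟ x)
  ... | true = refl
  ... | false = refl

  single-⟨$⟩ˡ : ∀ (π : Permutation′ m) x z i → single x z (π ⟨$⟩ˡ i) ≡ single (π ⟨$⟩ʳ x) z i
  single-⟨$⟩ˡ π x z i = by-cases (i F.≟ π ⟨$⟩ʳ x)
    where
    by-cases : Dec (i ≡ π ⟨$⟩ʳ x) → single x z (π ⟨$⟩ˡ i) ≡ single (π ⟨$⟩ʳ x) z i
    by-cases (yes refl) = trans (cong (single x z) (P.inverseˡ π)) (trans (single-≡ x z) (sym (single-≡ (π ⟨$⟩ʳ x) z)))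
    by-cases (no i≢πx) = trans (single-≢ z (⟨$⟩ˡ-≢ π i≢πx)) (sym (single-≢ z i≢πx))

-- Opened only here: its constructors assoc and _⁻¹ clash with the group fields opened above.
open import Defs

module SemidirectProduct (n : ℕ) where

  open ≡ using (sym; trans; cong; cong₂)

  inverse-cong : ∀ {π ρ : Permutation′ n} → π P.≈ ρ → ∀ i → π ⟨$⟩ˡ i ≡ ρ ⟨$⟩ˡ i
  inverse-cong {π} {ρ} eq i =
    trans (sym (P.inverseˡ ρ)) (cong (ρ ⟨$⟩ˡ_) (trans (sym (eq (π ⟨$⟩ˡ i))) (P.inverseʳ π)))

  εSD : SD n
  εSD = (λ _ → 0ℤ) , P.id

  invSD : SD n → SD n
  invSD (v , π) = (λ i → -ℤ (v (π ⟨$⟩ʳ i))) , P.flip π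

  -- A record around _≈SD_, so that both sides can be inferred from a proof.
  infix 4 _≋_
  record _≋_ (x y : SD n) : Set where
    constructor mk
    field get : x ≈SD y
  open _≋_ public

  private
    *SD-cong : ∀ {x y u w} → x ≋ y → u ≋ w → (x *SD u) ≋ (y *SD w)
    *SD-cong {v , π} {v' , π'} {w , ρ} {w' , ρ'} (mk (a , b)) (mk (c , d)) = mk (
      (λ i → cong₂ _+ℤ_ (a i) (trans (cong w (inverse-cong {π} {π'} b i)) (c _))) ,
      (λ i → trans (cong (π ⟨$⟩ʳ_) (d i)) (b _)))

    invSD-cong : ∀ {x y} → x ≋ y → invSD x ≋ invSD y
    invSD-cong {v , π} {v' , π'} (mk (a , b)) =
      mk ((λ i → cong -ℤ_ (trans (a _) (cong v' (b i)))) , inverse-cong {π} {π'} b)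

  semidirectGroup : Group _ _
  semidirectGroup = record
    { Carrier = SD n ; _≈_ = _≋_ ; _∙_ = _*SD_ ; ε = εSD ; _⁻¹ = invSD
    ; isGroup = record
      { isMonoid = record
        { isSemigroup = record
          { isMagma = record
            { isEquivalence = record
               { refl = mk ((λ _ → refl) , (λ _ → refl))
               ; sym = λ { (mk (a , b)) → mk ((λ i → sym (a i)) , (λ i → sym (b i))) }
               ; trans = λ { (mk (a , b)) (mk (c , d)) → mk ((λ i → trans (a i) (c i)) , (λ i → trans (b i) (d i))) } }
            ; ∙-cong = *SD-cong }
          ; assoc = λ { (v , π) (w , ρ) (u , κ) →
              mk ((λ i → ℤ.+-assoc (v i) (w (π ⟨$⟩ˡ i)) (u (ρ ⟨$⟩ˡ (π ⟨$⟩ˡ i)))) , (λ _ → refl)) } }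
        ; identity = (λ { (v , π) → mk ((λ i → ℤ.+-identityˡ (v i)) , (λ _ → refl)) })
                   , (λ { (v , π) → mk ((λ i → ℤ.+-identityʳ (v i)) , (λ _ → refl)) }) }
      ; inverse = (λ { (v , π) → mk ((λ i → ℤ.+-inverseˡ (v (π ⟨$⟩ʳ i))) , (λ _ → P.inverseˡ π)) })
                , (λ { (v , π) → mk ((λ i → trans (cong (λ z → v i +ℤ -ℤ (v z)) (P.inverseʳ π)) (ℤ.+-inverseʳ (v i)))
                                    , (λ _ → P.inverseʳ π)) })
      ; ⁻¹-cong = invSD-cong } }

  translations-commute : ∀ (x y : SD n) → proj₂ x P.≈ P.id → proj₂ y P.≈ P.id → (x *SD y) ≋ (y *SD x)
  translations-commute (v , π) (w , ρ) π≈id ρ≈id = mk (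
    (λ i → trans (cong (λ z → v i +ℤ w z) (inverse-cong {π} {P.id} π≈id i))
             (trans (ℤ.+-comm (v i) (w i)) (cong (λ z → w i +ℤ v z) (sym (inverse-cong {ρ} {P.id} ρ≈id i))))) ,
    (λ i → trans (cong (π ⟨$⟩ʳ_) (ρ≈id i)) (trans (π≈id i) (sym (trans (cong (ρ ⟨$⟩ʳ_) (π≈id i)) (ρ≈id i))))))

module Presentation (k : ℕ) where

  open ≡ using (sym; trans; cong; cong₂; subst)

  n n-1 : ℕ
  n = 4 + k
  n-1 = 3 + k

  wordGroup : Group _ _
  wordGroup = record
    { Carrier = Word ; _≈_ = n ⊢_≈_ ; _∙_ = _·_ ; ε = e ; _⁻¹ = _⁻¹
    ; isGroup = record
      { isMonoid = record
        { isSemigroup = record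
          { isMagma = record
            { isEquivalence = record { refl = ≈-refl ; sym = ≈-sym ; trans = ≈-trans }
            ; ∙-cong = ·-cong }
          ; assoc = assoc }
        ; identity = idˡ , idʳ }
      ; inverse = invˡ , invʳ
      ; ⁻¹-cong = ⁻¹-cong } }

  open GroupProperties wordGroup
  open Group wordGroup using (monoid; ∙-congˡ; ∙-congʳ)
  open import Algebra.Properties.Group wordGroup using (∙-cancelʳ)
  open import Relation.Binary.Reasoning.Setoid (Group.setoid wordGroup)

  open SemidirectProduct n
  module SD where
    open Group semidirectGroup public
    open GroupProperties semidirectGroup public
    open import Relation.Binary.Reasoning.Setoid setoid public

  ≡⇒≈ : ∀ {a b} → a ≡ b → n ⊢ a ≈ b
  ≡⇒≈ refl = ≈-refl

  pow≡^ : ∀ w m → pow w m ≡ w ^ m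
  pow≡^ w zero = refl
  pow≡^ w (suc m) = cong (w ·_) (pow≡^ w m)

  pt : ℕ → Fin n
  pt = clamp

  pt-≢ : ∀ x y → x ≤ n-1 → y ≤ n-1 → x ≢ y → pt x ≢ pt y
  pt-≢ = clamp-≢

  +-suc-≤ : ∀ {j m b} → j + suc m ≤ b → suc j + m ≤ b
  +-suc-≤ {j} {m} {b} = subst (_≤ b) (ℕ.+-suc j m)

  swap : ℕ → Permutation′ n
  swap i = P.transpose (pt i) (pt (suc i))

  swapsUp : ℕ → ℕ → Permutation′ n
  swapsUp j zero = P.id
  swapsUp j (suc m) = swap j ∘S swapsUp (suc j) m

  swapsUp-below : ∀ j m x → x < j → j + m ≤ n-1 → swapsUp j m ⟨$⟩ʳ pt x ≡ pt x
  swapsUp-below j zero x x<j le = refl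
  swapsUp-below j (suc m) x x<j le =
    trans (cong (swap j ⟨$⟩ʳ_) (swapsUp-below (suc j) m x (ℕ.m<n⇒m<1+n x<j) (+-suc-≤ le)))
          (transpose-apply-≢ (pt-≢ x j x≤ j≤ (ℕ.<⇒≢ x<j)) (pt-≢ x (suc j) x≤ 1+j≤ (ℕ.<⇒≢ (ℕ.m<n⇒m<1+n x<j))))
    where
    j≤ : j ≤ n-1
    j≤ = ℕ.≤-trans (ℕ.m≤m+n j (suc m)) le
    1+j≤ : suc j ≤ n-1
    1+j≤ = ℕ.≤-trans (ℕ.m<m+n j (s≤s z≤n)) le
    x≤ : x ≤ n-1
    x≤ = ℕ.≤-trans (ℕ.<⇒≤ x<j) j≤

  swapsUp-top : ∀ j m → j + m ≤ n-1 → swapsUp j m ⟨$⟩ʳ pt (j + m) ≡ pt j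
  swapsUp-top j zero le = cong pt (ℕ.+-identityʳ j)
  swapsUp-top j (suc m) le =
    trans (cong (λ z → swap j ⟨$⟩ʳ (swapsUp (suc j) m ⟨$⟩ʳ pt z)) (ℕ.+-suc j m))
      (trans (cong (swap j ⟨$⟩ʳ_) (swapsUp-top (suc j) m (+-suc-≤ le))) (transpose-applyʳ (pt j) (pt (suc j))))

  swapsUp-inside : ∀ j m x → j ≤ x → x < j + m → j + m ≤ n-1 → swapsUp j m ⟨$⟩ʳ pt x ≡ pt (suc x)
  swapsUp-inside j zero x j≤x x<j+0 le = ⊥-elim (ℕ.<-irrefl refl (ℕ.<-≤-trans x<j+0 (subst (_≤ x) (sym (ℕ.+-identityʳ j)) j≤x)))
  swapsUp-inside j (suc m) x j≤x x< le with x ℕ.≟ j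
  ... | yes refl = trans (cong (swap j ⟨$⟩ʳ_) (swapsUp-below (suc j) m x (ℕ.n<1+n x) (+-suc-≤ le)))
                         (transpose-applyˡ (pt j) (pt (suc j)))
  ... | no x≢j =
    trans (cong (swap j ⟨$⟩ʳ_) (swapsUp-inside (suc j) m x j<x (subst (x <_) (ℕ.+-suc j m) x<) (+-suc-≤ le)))
      (transpose-apply-≢ (pt-≢ (suc x) j 1+x≤ j≤ (ℕ.>⇒≢ (s≤s j≤x)))
                         (pt-≢ (suc x) (suc j) 1+x≤ (ℕ.≤-trans j<x (ℕ.≤-trans (ℕ.n≤1+n x) 1+x≤)) (ℕ.>⇒≢ (s≤s j<x))))
    where
    j<x : j < x
    j<x = ℕ.≤∧≢⇒< j≤x (x≢j ∘ sym)
    1+x≤ : suc x ≤ n-1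
    1+x≤ = ℕ.≤-trans x< le
    j≤ : j ≤ n-1
    j≤ = ℕ.≤-trans (ℕ.≤-trans j≤x (ℕ.n≤1+n x)) 1+x≤

  -- The n-cycle i ↦ i + 1. Opaque: with it unfolded, type checking becomes prohibitively slow.
  opaque
    cycle : Permutation′ n
    cycle = swapsUp 0 n-1

    cycle≡swapsUp : cycle ≡ swapsUp 0 n-1
    cycle≡swapsUp = refl

  cycle-suc : ∀ x → x < n-1 → cycle ⟨$⟩ʳ pt x ≡ pt (suc x)
  cycle-suc x x< rewrite cycle≡swapsUp = swapsUp-inside 0 n-1 x z≤n x< ℕ.≤-refl

  cycle-top : cycle ⟨$⟩ʳ pt n-1 ≡ pt 0
  cycle-top rewrite cycle≡swapsUp = swapsUp-top 0 n-1 ℕ.≤-refl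

  infixr 8 _^ₚ_
  _^ₚ_ : Permutation′ n → ℕ → Permutation′ n
  π ^ₚ zero = P.id
  π ^ₚ suc m = π ∘S (π ^ₚ m)

  ^ₚ-sucʳ : ∀ π m x → π ^ₚ suc m ⟨$⟩ʳ x ≡ π ^ₚ m ⟨$⟩ʳ (π ⟨$⟩ʳ x)
  ^ₚ-sucʳ π zero x = refl
  ^ₚ-sucʳ π (suc m) x = cong (π ⟨$⟩ʳ_) (^ₚ-sucʳ π m x)

  cycle^ : ∀ i x → i + x ≤ n-1 → cycle ^ₚ i ⟨$⟩ʳ pt x ≡ pt (i + x)
  cycle^ zero x le = refl
  cycle^ (suc i) x le = trans (cong (cycle ⟨$⟩ʳ_) (cycle^ i x (ℕ.≤-trans (ℕ.n≤1+n _) le))) (cycle-suc (i + x) le)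

  cycle^-conj-swap₀ : ∀ i → i < n-1 → ∀ x →
    cycle ^ₚ i ⟨$⟩ʳ (swap 0 ⟨$⟩ʳ (cycle ^ₚ i ⟨$⟩ˡ x)) ≡ swap i ⟨$⟩ʳ x
  cycle^-conj-swap₀ i i< x =
    trans (transpose-conj (cycle ^ₚ i) (pt 0) (pt 1) x) (cong₂ (λ a b → P.transpose a b ⟨$⟩ʳ x) c0 c1)
    where
    c0 : cycle ^ₚ i ⟨$⟩ʳ pt 0 ≡ pt i
    c0 = trans (cycle^ i 0 (subst (_≤ n-1) (sym (ℕ.+-identityʳ i)) (ℕ.<⇒≤ i<))) (cong pt (ℕ.+-identityʳ i))
    c1 : cycle ^ₚ i ⟨$⟩ʳ pt 1 ≡ pt (suc i)
    c1 = trans (cycle^ i 1 (subst (_≤ n-1) (ℕ.+-comm 1 i) i<)) (cong pt (ℕ.+-comm i 1))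

  -- The homomorphism

  permElt : Permutation′ n → SD n
  permElt π = (λ _ → 0ℤ) , π

  evalGen : Gen → SD n
  evalGen σ = permElt (swap 0)
  evalGen τ = permElt cycle
  evalGen γ = single (pt n-1) 1ℤ , P.id

  eval : Word → SD n
  eval (gen x) = evalGen x
  eval e = εSD
  eval (a · b) = eval a *SD eval b
  eval (a ⁻¹) = invSD (eval a)

  perm : Word → Permutation′ n
  perm u = proj₂ (eval u)

  eval-^ : ∀ w m → eval (w ^ m) ≡ eval w SD.^ m
  eval-^ w zero = refl
  eval-^ w (suc m) = cong (eval w *SD_) (eval-^ w m)

  eval-pow : ∀ w m → eval (pow w m) ≡ eval w SD.^ m
  eval-pow w m = trans (cong eval (pow≡^ w m)) (eval-^ w m)

  permElt-^ : ∀ π m → permElt π SD.^ m ≡ permElt (π ^ₚ m)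
  permElt-^ π zero = refl
  permElt-^ π (suc m) = cong (permElt π *SD_) (permElt-^ π m)

  sᵢ : ℕ → Word
  sᵢ i = conj (t ^ i) s

  eval-sᵢ : ∀ i → i < n-1 → eval (sᵢ i) ≋ permElt (swap i)
  eval-sᵢ i i< rewrite eval-^ t i | permElt-^ cycle i = mk ((λ _ → refl) , cycle^-conj-swap₀ i i<)

  conjT≡conj : ∀ i x → conjT i x ≡ conj (t ^ i) x
  conjT≡conj i x = cong (λ p → (p · x) · p ⁻¹) (pow≡^ t i)

  eval-rel₁ : eval (pow s 2) ≋ eval e
  eval-rel₁ = mk ((λ _ → refl) , transpose-involutive (pt 0) (pt 1))

  swap₀swap₁-cube : ∀ x → let B = λ y → swap 0 ⟨$⟩ʳ (swap 1 ⟨$⟩ʳ y) in B (B (B x)) ≡ x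
  swap₀swap₁-cube F.zero = refl
  swap₀swap₁-cube (F.suc F.zero) = refl
  swap₀swap₁-cube (F.suc (F.suc F.zero)) = refl
  swap₀swap₁-cube (F.suc (F.suc (F.suc x))) = refl

  eval-rel₂ : eval (pow (s · t · s · t ⁻¹) 3) ≋ eval e
  eval-rel₂ = mk ((λ _ → refl) , λ x →
    trans (cong (λ z → X (X z)) (X≡ x)) (trans (cong X (X≡ _)) (trans (X≡ _) (swap₀swap₁-cube x))))
    where
    X : Fin n → Fin n
    X y = swap 0 ⟨$⟩ʳ (cycle ⟨$⟩ʳ (swap 0 ⟨$⟩ʳ (cycle ⟨$⟩ˡ y)))
    X≡ : ∀ y → X y ≡ swap 0 ⟨$⟩ʳ (swap 1 ⟨$⟩ʳ y)
    X≡ y = cong (swap 0 ⟨$⟩ʳ_) (cycle^-conj-swap₀ 1 (s≤s (s≤s z≤n)) y)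

  eval-rel₃ : ∀ m → 2 ≤ m → m ≤ n ∸ 2 → eval (pow (s · pow t m · s · (pow t m) ⁻¹) 2) ≋ eval e
  eval-rel₃ m 2≤m m≤ rewrite eval-pow t m | permElt-^ cycle m =
    mk ((λ _ → refl) , λ y → trans (cong X (X≡ y)) (trans (X≡ _) (swap₀swapₘ-square y)))
    where
    X : Fin n → Fin n
    X y = swap 0 ⟨$⟩ʳ (cycle ^ₚ m ⟨$⟩ʳ (swap 0 ⟨$⟩ʳ (cycle ^ₚ m ⟨$⟩ˡ y)))
    m<n-1 : m < n-1
    m<n-1 = s≤s m≤
    X≡ : ∀ y → X y ≡ swap 0 ⟨$⟩ʳ (swap m ⟨$⟩ʳ y)
    X≡ y = cong (swap 0 ⟨$⟩ʳ_) (cycle^-conj-swap₀ m m<n-1 y)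
    below-m : ∀ a → a < 2 → pt a ≢ pt m × pt a ≢ pt (suc m)
    below-m a a<2 = pt-≢ a m a≤ m≤n-1 (ℕ.<⇒≢ (ℕ.<-≤-trans a<2 2≤m))
                  , pt-≢ a (suc m) a≤ m<n-1 (ℕ.<⇒≢ (ℕ.<-≤-trans a<2 (ℕ.≤-trans 2≤m (ℕ.n≤1+n m))))
      where
      m≤n-1 : m ≤ n-1
      m≤n-1 = ℕ.<⇒≤ m<n-1
      a≤ : a ≤ n-1
      a≤ = ℕ.≤-trans (ℕ.<⇒≤ a<2) (ℕ.≤-trans 2≤m m≤n-1)
    T : ℕ → Fin n → Fin n
    T i y = swap i ⟨$⟩ʳ y
    swap₀swapₘ-square : ∀ y → T 0 (T m (T 0 (T m y))) ≡ y
    swap₀swapₘ-square y =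
      trans (cong (T 0) (sym (transpose-disjoint-comm (proj₁ (below-m 0 (s≤s z≤n))) (proj₂ (below-m 0 (s≤s z≤n)))
                                                      (proj₁ (below-m 1 (s≤s (s≤s z≤n)))) (proj₂ (below-m 1 (s≤s (s≤s z≤n))))
                                                      (T m y))))
            (trans (transpose-involutive _ _ _) (transpose-involutive _ _ y))

  conjProduct-eval : ∀ j m → j + m ≤ n-1 → SD.conjProduct (eval s) (eval t) j m ≋ permElt (swapsUp j m)
  conjProduct-eval j zero le = SD.refl
  conjProduct-eval j (suc m) le =
    SD.∙-cong (subst (_≋ permElt (swap j)) eval-sᵢ≡ (eval-sᵢ j (ℕ.<-≤-trans (ℕ.m<m+n j (s≤s z≤n)) le)))
              (conjProduct-eval (suc j) m (+-suc-≤ le))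
    where
    eval-sᵢ≡ : eval (sᵢ j) ≡ SD.conj (eval t SD.^ j) (eval s)
    eval-sᵢ≡ = cong (λ p → (p *SD eval s) *SD invSD p) (eval-^ t j)

  eval-rel₄ : eval (pow (s · t) n-1) ≋ eval (pow t n)
  eval-rel₄ = SD.begin
    eval (pow (s · t) n-1)                                  SD.≡⟨ eval-pow (s · t) n-1 ⟩
    (eval s *SD eval t) SD.^ n-1                            SD.≈⟨ SD.^-∙-conjProduct (eval s) (eval t) n-1 ⟩
    SD.conjProduct (eval s) (eval t) 0 n-1 *SD (eval t SD.^ n-1)
      SD.≈⟨ SD.∙-congʳ {eval t SD.^ n-1} (conjProduct-eval 0 n-1 ℕ.≤-refl) ⟩
    permElt (swapsUp 0 n-1) *SD (eval t SD.^ n-1)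
      SD.≡⟨ cong (λ π → permElt π *SD (eval t SD.^ n-1)) (sym cycle≡swapsUp) ⟩
    eval t SD.^ n                                           SD.≡⟨ sym (eval-pow t n) ⟩
    eval (pow t n)                                          SD.∎

  γ-commute-fixing : ∀ π → π ⟨$⟩ʳ pt n-1 ≡ pt n-1 → (evalGen γ *SD permElt π) ≋ (permElt π *SD evalGen γ)
  γ-commute-fixing π fixes = mk (
    (λ i → trans (ℤ.+-identityʳ _) (sym (trans (ℤ.+-identityˡ _)
                                              (trans (single-⟨$⟩ˡ π (pt n-1) 1ℤ i) (cong (λ x → single x 1ℤ i) fixes))))) ,
    (λ _ → refl))

  eval-rel₅ : ∀ j → j ≤ n ∸ 3 → eval (g · sᵢ j) ≋ eval (sᵢ j · g)
  eval-rel₅ j j≤ = SD.begin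
    eval g *SD eval (sᵢ j)       SD.≈⟨ SD.∙-congˡ {eval g} (eval-sᵢ j j<n-1) ⟩
    eval g *SD permElt (swap j)  SD.≈⟨ γ-commute-fixing (swap j) swap-fixes-top ⟩
    permElt (swap j) *SD eval g  SD.≈⟨ SD.∙-congʳ {eval g} (SD.sym (eval-sᵢ j j<n-1)) ⟩
    eval (sᵢ j) *SD eval g       SD.∎
    where
    j<n-1 : j < n-1
    j<n-1 = s≤s (ℕ.≤-trans j≤ (ℕ.n≤1+n _))
    swap-fixes-top : swap j ⟨$⟩ʳ pt n-1 ≡ pt n-1
    swap-fixes-top = transpose-apply-≢ (pt-≢ n-1 j ℕ.≤-refl (ℕ.<⇒≤ j<n-1) (ℕ.>⇒≢ j<n-1))
                                       (pt-≢ n-1 (suc j) ℕ.≤-refl j<n-1 (ℕ.>⇒≢ (s≤s (s≤s j≤))))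

  eval-rel₆ : ∀ l → eval (g · conjT l g) ≋ eval (conjT l g · g)
  eval-rel₆ l = translations-commute (eval g) (eval (conjT l g)) (λ _ → refl) (λ _ → P.inverseʳ (perm (pow t l)))

  eval-sound : ∀ {a b} → n ⊢ a ≈ b → eval a ≋ eval b
  eval-sound ≈-refl = SD.refl
  eval-sound (≈-sym p) = SD.sym (eval-sound p)
  eval-sound (≈-trans p q) = SD.trans (eval-sound p) (eval-sound q)
  eval-sound (·-cong p q) = SD.∙-cong (eval-sound p) (eval-sound q)
  eval-sound (⁻¹-cong p) = SD.⁻¹-cong (eval-sound p)
  eval-sound (assoc a b c) = SD.assoc (eval a) (eval b) (eval c)
  eval-sound (idˡ a) = SD.identityˡ (eval a)
  eval-sound (idʳ a) = SD.identityʳ (eval a)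
  eval-sound (invˡ a) = SD.inverseˡ (eval a)
  eval-sound (invʳ a) = SD.inverseʳ (eval a)
  eval-sound rel₁ = eval-rel₁
  eval-sound rel₂ = eval-rel₂
  eval-sound (rel₃ m 2≤m m≤) = eval-rel₃ m 2≤m m≤
  eval-sound rel₄ = eval-rel₄
  eval-sound (rel₅ j j≤) = subst (λ w → eval (g · w) ≋ eval (w · g)) (sym (conjT≡conj j s)) (eval-rel₅ j j≤)
  eval-sound (rel₆ l _ _) = eval-rel₆ l

  -- The Coxeter relations of the sᵢ

  s-involutive : n ⊢ s ^ 2 ≈ e
  s-involutive = ≈-trans (≡⇒≈ (sym (pow≡^ s 2))) rel₁

  sᵢ-involutive : ∀ i → n ⊢ sᵢ i ^ 2 ≈ e
  sᵢ-involutive i = begin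
    conj (t ^ i) s ^ 2    ≈⟨ ≈-sym (conj-^ (t ^ i) s 2) ⟩
    conj (t ^ i) (s ^ 2)  ≈⟨ conj-congʳ (t ^ i) s-involutive ⟩
    conj (t ^ i) e        ≈⟨ conj-ε (t ^ i) ⟩
    e                     ∎

  conj-sᵢ : ∀ i j → n ⊢ conj (t ^ i) (sᵢ j) ≈ sᵢ (i + j)
  conj-sᵢ i j = ≈-trans (conj-conj (t ^ i) (t ^ j) s) (conj-congˡ s (≈-sym (^-+ t i j)))

  sᵢ-pair-^ : ∀ i m r → n ⊢ (sᵢ 0 · sᵢ m) ^ r ≈ e → n ⊢ (sᵢ i · sᵢ (i + m)) ^ r ≈ e
  sᵢ-pair-^ i m r pair₀ = begin
    (sᵢ i · sᵢ (i + m)) ^ r          ≈⟨ ^-congˡ r (≈-sym conj-pair) ⟩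
    conj (t ^ i) (sᵢ 0 · sᵢ m) ^ r   ≈⟨ ≈-sym (conj-^ (t ^ i) _ r) ⟩
    conj (t ^ i) ((sᵢ 0 · sᵢ m) ^ r) ≈⟨ conj-congʳ (t ^ i) pair₀ ⟩
    conj (t ^ i) e                   ≈⟨ conj-ε (t ^ i) ⟩
    e                                ∎
    where
    conj-pair : n ⊢ conj (t ^ i) (sᵢ 0 · sᵢ m) ≈ sᵢ i · sᵢ (i + m)
    conj-pair = ≈-trans (conj-∙ (t ^ i) (sᵢ 0) (sᵢ m))
                        (·-cong (≈-trans (conj-sᵢ i 0) (≡⇒≈ (cong sᵢ (ℕ.+-identityʳ i)))) (conj-sᵢ i m))

  s₀sₘ≈ : ∀ m → n ⊢ sᵢ 0 · sᵢ m ≈ s · pow t m · s · (pow t m) ⁻¹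
  s₀sₘ≈ m = begin
    sᵢ 0 · sᵢ m                           ≈⟨ ·-cong (conj-identity s) ≈-refl ⟩
    s · ((t ^ m · s) · (t ^ m) ⁻¹)        ≈⟨ solve monoid ⟩
    s · t ^ m · s · (t ^ m) ⁻¹            ≡⟨ cong (λ p → s · p · s · p ⁻¹) (sym (pow≡^ t m)) ⟩
    s · pow t m · s · (pow t m) ⁻¹        ∎

  sᵢ-braid : ∀ i → n ⊢ sᵢ i · sᵢ (suc i) · sᵢ i ≈ sᵢ (suc i) · sᵢ i · sᵢ (suc i)
  sᵢ-braid i = involutions-braid (sᵢ-involutive i) (sᵢ-involutive (suc i))
                 (subst (λ j → n ⊢ (sᵢ i · sᵢ j) ^ 3 ≈ e) (ℕ.+-comm i 1) (sᵢ-pair-^ i 1 3 cube₀))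
    where
    pow-t-1 : n ⊢ s · pow t 1 · s · (pow t 1) ⁻¹ ≈ s · t · s · t ⁻¹
    pow-t-1 = ·-cong (·-cong (·-cong ≈-refl (idʳ t)) ≈-refl) (⁻¹-cong (idʳ t))
    cube₀ : n ⊢ (sᵢ 0 · sᵢ 1) ^ 3 ≈ e
    cube₀ = begin
      (sᵢ 0 · sᵢ 1) ^ 3           ≈⟨ ^-congˡ 3 (≈-trans (s₀sₘ≈ 1) pow-t-1) ⟩
      (s · t · s · t ⁻¹) ^ 3      ≡⟨ sym (pow≡^ _ 3) ⟩
      pow (s · t · s · t ⁻¹) 3    ≈⟨ rel₂ ⟩
      e                           ∎

  sᵢ-comm : ∀ i j → suc i < j → j < n-1 → Commute (sᵢ i) (sᵢ j)
  sᵢ-comm i j i+1<j j<n-1 =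
    subst (λ j → Commute (sᵢ i) (sᵢ j)) i+m≡j
      (involutions-commute (sᵢ-involutive i) (sᵢ-involutive (i + m)) (sᵢ-pair-^ i m 2 square₀))
    where
    m : ℕ
    m = j ∸ i
    i+m≡j : i + m ≡ j
    i+m≡j = ℕ.m+[n∸m]≡n (ℕ.≤-trans (ℕ.n≤1+n i) (ℕ.<⇒≤ i+1<j))
    2≤m : 2 ≤ m
    2≤m = subst (_≤ m) (trans (cong (_∸ i) (ℕ.+-comm 2 i)) (ℕ.m+n∸m≡n i 2)) (ℕ.∸-monoˡ-≤ i i+1<j)
    square₀ : n ⊢ (sᵢ 0 · sᵢ m) ^ 2 ≈ e
    square₀ = begin
      (sᵢ 0 · sᵢ m) ^ 2                         ≈⟨ ^-congˡ 2 (s₀sₘ≈ m) ⟩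
      (s · pow t m · s · (pow t m) ⁻¹) ^ 2      ≡⟨ sym (pow≡^ _ 2) ⟩
      pow (s · pow t m · s · (pow t m) ⁻¹) 2    ≈⟨ rel₃ m 2≤m (ℕ.≤-trans (ℕ.m∸n≤m j i) (ℕ.≤-pred j<n-1)) ⟩
      e                                         ∎

  t≈sUp : n ⊢ t ≈ conjProduct s t 0 n-1
  t≈sUp = ∙-cancelʳ (t ^ n-1) t (conjProduct s t 0 n-1) (begin
    t ^ n                                   ≡⟨ sym (pow≡^ t n) ⟩
    pow t n                                 ≈⟨ ≈-sym rel₄ ⟩
    pow (s · t) n-1                         ≡⟨ pow≡^ (s · t) n-1 ⟩
    (s · t) ^ n-1                           ≈⟨ ^-∙-conjProduct s t n-1 ⟩
    conjProduct s t 0 n-1 · t ^ n-1         ∎)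

  sDown : ℕ → ℕ → Word
  sDown j zero = e
  sDown j (suc m) = sDown (suc j) m · sᵢ j

  swapsDown : ℕ → ℕ → Permutation′ n
  swapsDown j zero = P.id
  swapsDown j (suc m) = swapsDown (suc j) m ∘S swap j

  swapsDown-start : ∀ j m → j + m ≤ n-1 → swapsDown j m ⟨$⟩ʳ pt j ≡ pt (j + m)
  swapsDown-start j zero le = cong pt (sym (ℕ.+-identityʳ j))
  swapsDown-start j (suc m) le =
    trans (cong (swapsDown (suc j) m ⟨$⟩ʳ_) (transpose-applyˡ (pt j) (pt (suc j))))
          (trans (swapsDown-start (suc j) m (+-suc-≤ le)) (cong pt (sym (ℕ.+-suc j m))))

  swapsDown-above : ∀ j m y → j + m < y → y ≤ n-1 → swapsDown j m ⟨$⟩ʳ pt y ≡ pt y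
  swapsDown-above j zero y lt le = refl
  swapsDown-above j (suc m) y lt le =
    trans (cong (swapsDown (suc j) m ⟨$⟩ʳ_)
                (transpose-apply-≢ (pt-≢ y j le (ℕ.≤-trans (ℕ.<⇒≤ j<y) le) (ℕ.>⇒≢ j<y))
                                   (pt-≢ y (suc j) le (ℕ.≤-trans (ℕ.<⇒≤ j+1<y) le) (ℕ.>⇒≢ j+1<y))))
          (swapsDown-above (suc j) m y (subst (_< y) (ℕ.+-suc j m) lt) le)
    where
    j+1<y : suc j < y
    j+1<y = ℕ.<-≤-trans (s≤s (ℕ.m<m+n j (s≤s z≤n))) lt
    j<y : j < y
    j<y = ℕ.<-trans (ℕ.n<1+n j) j+1<y

  eval-sDown : ∀ j m → j + m ≤ n-1 → eval (sDown j m) ≋ permElt (swapsDown j m)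
  eval-sDown j zero le = SD.refl
  eval-sDown j (suc m) le =
    SD.∙-cong (eval-sDown (suc j) m (+-suc-≤ le)) (eval-sᵢ j (ℕ.<-≤-trans (ℕ.m<m+n j (s≤s z≤n)) le))

  sᵢ-commute-sDown : ∀ i j m → suc i < j → j + m ≤ n-1 → Commute (sᵢ i) (sDown j m)
  sᵢ-commute-sDown i j zero lt le = commute-ε (sᵢ i)
  sᵢ-commute-sDown i j (suc m) lt le =
    commute-∙ (sᵢ-commute-sDown i (suc j) m (ℕ.m<n⇒m<1+n lt) (+-suc-≤ le))
              (sᵢ-comm i j lt (ℕ.<-≤-trans (ℕ.m<m+n j (s≤s z≤n)) le))

  sDown-shift : ∀ j m i → j ≤ i → suc (suc i) ≤ j + m → j + m ≤ n-1 →
    n ⊢ sDown j m · sᵢ (suc i) ≈ sᵢ i · sDown j m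
  sDown-shift j zero i j≤i lt le =
    ⊥-elim (ℕ.<-irrefl refl (ℕ.≤-trans lt (subst (_≤ suc i) (sym (ℕ.+-identityʳ j)) (ℕ.m≤n⇒m≤1+n j≤i))))
  sDown-shift j (suc m) i j≤i lt le with j ℕ.≟ i
  sDown-shift j (suc zero) .j j≤i lt le | yes refl = ⊥-elim (ℕ.<-irrefl (ℕ.+-comm 1 j) lt)
  sDown-shift j (suc (suc m)) .j j≤i lt le | yes refl = begin
    ((E · sᵢ (suc j)) · sᵢ j) · sᵢ (suc j)   ≈⟨ solve monoid ⟩
    E · ((sᵢ (suc j) · sᵢ j) · sᵢ (suc j))   ≈⟨ ∙-congˡ (≈-sym (sᵢ-braid j)) ⟩
    E · ((sᵢ j · sᵢ (suc j)) · sᵢ j)         ≈⟨ solve monoid ⟩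
    (E · sᵢ j) · (sᵢ (suc j) · sᵢ j)         ≈⟨ ∙-congʳ (≈-sym (sᵢ-commute-sDown j (suc (suc j)) m (ℕ.n<1+n (suc j)) j+2+m≤)) ⟩
    (sᵢ j · E) · (sᵢ (suc j) · sᵢ j)         ≈⟨ solve monoid ⟩
    sᵢ j · ((E · sᵢ (suc j)) · sᵢ j)         ∎
    where
    E : Word
    E = sDown (suc (suc j)) m
    j+2+m≤ : suc (suc j) + m ≤ n-1
    j+2+m≤ = +-suc-≤ {suc j} {m} (+-suc-≤ {j} {suc m} le)
  ... | no j≢i = begin
    (sDown (suc j) m · sᵢ j) · sᵢ (suc i)   ≈⟨ assoc _ _ _ ⟩
    sDown (suc j) m · (sᵢ j · sᵢ (suc i))   ≈⟨ ∙-congˡ (sᵢ-comm j (suc i) (s≤s j<i) (ℕ.<-≤-trans (ℕ.n<1+n (suc i)) (ℕ.≤-trans lt le))) ⟩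
    sDown (suc j) m · (sᵢ (suc i) · sᵢ j)   ≈⟨ ≈-sym (assoc _ _ _) ⟩
    (sDown (suc j) m · sᵢ (suc i)) · sᵢ j   ≈⟨ ∙-congʳ (sDown-shift (suc j) m i j<i (subst (suc (suc i) ≤_) (ℕ.+-suc j m) lt) (+-suc-≤ le)) ⟩
    (sᵢ i · sDown (suc j) m) · sᵢ j         ≈⟨ assoc _ _ _ ⟩
    sᵢ i · (sDown (suc j) m · sᵢ j)         ∎
    where
    j<i : j < i
    j<i = ℕ.≤∧≢⇒< j≤i j≢i

  perm-≈ : ∀ {a b} → n ⊢ a ≈ b → perm a P.≈ perm b
  perm-≈ a≈b = proj₂ (get (eval-sound a≈b))

  -- Identities between the permutations of the sᵢ and of sDown are read off from the corresponding
  -- word identities through eval-sound, rather than checked point by point.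
  perm-square : ∀ {a b c d} (α β γ δ : Permutation′ n) → n ⊢ a · b ≈ c · d →
    perm a P.≈ α → perm b P.≈ β → perm c P.≈ γ → perm d P.≈ δ →
    ∀ y → α ⟨$⟩ʳ (β ⟨$⟩ʳ y) ≡ γ ⟨$⟩ʳ (δ ⟨$⟩ʳ y)
  perm-square {a} {b} {c} {d} _ _ _ _ ab≈cd a≈ b≈ c≈ d≈ y =
    trans (sym (trans (cong (perm a ⟨$⟩ʳ_) (b≈ y)) (a≈ _)))
      (trans (perm-≈ ab≈cd y) (trans (cong (perm c ⟨$⟩ʳ_) (d≈ y)) (c≈ _)))

  perm-sᵢ : ∀ i → i < n-1 → perm (sᵢ i) P.≈ swap i
  perm-sᵢ i i< = proj₂ (get (eval-sᵢ i i<))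

  perm-sDown : ∀ j m → j + m ≤ n-1 → perm (sDown j m) P.≈ swapsDown j m
  perm-sDown j m le = proj₂ (get (eval-sDown j m le))

  swapsDown-comm : ∀ j m i → suc i < j → j + m ≤ n-1 →
    ∀ y → swapsDown j m ⟨$⟩ʳ (swap i ⟨$⟩ʳ y) ≡ swap i ⟨$⟩ʳ (swapsDown j m ⟨$⟩ʳ y)
  swapsDown-comm j m i lt le =
    perm-square (swapsDown j m) (swap i) (swap i) (swapsDown j m) (≈-sym (sᵢ-commute-sDown i j m lt le))
                (perm-sDown j m le) (perm-sᵢ i i<) (perm-sᵢ i i<) (perm-sDown j m le)
    where
    i< : i < n-1
    i< = ℕ.<-trans (ℕ.n<1+n i) (ℕ.<-≤-trans lt (ℕ.≤-trans (ℕ.m≤m+n j m) le))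

  swapsDown-shift : ∀ j m i → j ≤ i → suc (suc i) ≤ j + m → j + m ≤ n-1 →
    ∀ y → swapsDown j m ⟨$⟩ʳ (swap (suc i) ⟨$⟩ʳ y) ≡ swap i ⟨$⟩ʳ (swapsDown j m ⟨$⟩ʳ y)
  swapsDown-shift j m i j≤i lt le =
    perm-square (swapsDown j m) (swap (suc i)) (swap i) (swapsDown j m) (sDown-shift j m i j≤i lt le)
                (perm-sDown j m le) (perm-sᵢ (suc i) i+1<)
                (perm-sᵢ i (ℕ.<-trans (ℕ.n<1+n i) i+1<)) (perm-sDown j m le)
    where
    i+1< : suc i < n-1
    i+1< = ℕ.≤-trans lt le

  -- Normal forms of permutations

  FixesFrom : ℕ → Permutation′ n → Set
  FixesFrom q π = ∀ x → q ≤ toℕ x → π ⟨$⟩ʳ x ≡ x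

  preimageIndex : ℕ → Permutation′ n → ℕ
  preimageIndex q π = toℕ (π ⟨$⟩ˡ pt q)

  -- For π fixing every point above q, with j = π⁻¹(q): swapsDown j (q ∸ j) sends j to q, so
  -- π ∘ (swapsDown j (q ∸ j))⁻¹ fixes every point from q on, and the recursion peels off q.
  permWord : ℕ → Permutation′ n → Word
  permWord zero π = e
  permWord (suc q) π =
    permWord q (π ∘S P.flip (swapsDown (preimageIndex q π) (q ∸ preimageIndex q π)))
      · sDown (preimageIndex q π) (q ∸ preimageIndex q π)

  permWordStep : ℕ → Permutation′ n → ℕ → ℕ → Word
  permWordStep q π j m = permWord q (π ∘S P.flip (swapsDown j m)) · sDown j m

  permWord-cong : ∀ q {π ρ} → π P.≈ ρ → permWord q π ≡ permWord q ρ
  permWord-cong zero eq = refl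
  permWord-cong (suc q) {π} {ρ} eq =
    trans (cong (λ j → permWordStep q π j (q ∸ j)) (cong toℕ (inverse-cong {π} {ρ} eq (pt q))))
          (cong (_· sDown (preimageIndex q ρ) (q ∸ preimageIndex q ρ)) (permWord-cong q (λ x → eq _)))

  permWord-unfold : ∀ q π j m → π ⟨$⟩ˡ pt q ≡ pt j → j + m ≡ q → q ≤ n-1 → permWord (suc q) π ≡ permWordStep q π j m
  permWord-unfold q π j m π⁻¹q≡j j+m≡q q≤ = cong₂ (permWordStep q π) index≡j (trans (cong (q ∸_) index≡j) q∸j≡m)
    where
    index≡j : preimageIndex q π ≡ j
    index≡j = trans (cong toℕ π⁻¹q≡j) (toℕ-clamp j (ℕ.≤-trans (ℕ.m≤m+n j m) (subst (_≤ n-1) (sym j+m≡q) q≤)))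
    q∸j≡m : q ∸ j ≡ m
    q∸j≡m = trans (cong (_∸ j) (sym j+m≡q)) (ℕ.m+n∸m≡n j m)

  preimageIndex-≤ : ∀ q π → FixesFrom (suc q) π → q ≤ n-1 → preimageIndex q π ≤ q
  preimageIndex-≤ q π fixes q≤ with suc q ℕ.≤? preimageIndex q π
  ... | no q≮ = ℕ.≤-pred (ℕ.≰⇒> q≮)
  ... | yes q< = ⊥-elim (ℕ.<-irrefl (sym index≡q) q<)
    where
    index≡q : preimageIndex q π ≡ q
    index≡q = trans (cong toℕ (trans (sym (fixes _ q<)) (P.inverseʳ π))) (toℕ-clamp q q≤)

  fixesFrom-peel : ∀ q π j m → FixesFrom (suc q) π → π ⟨$⟩ˡ pt q ≡ pt j → j + m ≡ q → q ≤ n-1 →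
    FixesFrom q (π ∘S P.flip (swapsDown j m))
  fixesFrom-peel q π j m fixes π⁻¹q≡j j+m≡q q≤ x q≤x with toℕ x ℕ.≟ q
  ... | yes x≡q = trans (cong (λ z → π ⟨$⟩ʳ (swapsDown j m ⟨$⟩ˡ z)) x≡pt)
                   (trans (cong (π ⟨$⟩ʳ_) (trans (cong (swapsDown j m ⟨$⟩ˡ_) (sym down-j)) (P.inverseˡ (swapsDown j m))))
                     (trans (cong (π ⟨$⟩ʳ_) (sym π⁻¹q≡j)) (trans (P.inverseʳ π) (sym x≡pt))))
    where
    x≡pt : x ≡ pt q
    x≡pt = trans (sym (clamp-toℕ x)) (cong pt x≡q)
    down-j : swapsDown j m ⟨$⟩ʳ pt j ≡ pt q
    down-j = trans (swapsDown-start j m (subst (_≤ n-1) (sym j+m≡q) q≤)) (cong pt j+m≡q)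
  ... | no x≢q = trans (cong (π ⟨$⟩ʳ_) down⁻¹-x) (fixes x q<x)
    where
    q<x : suc q ≤ toℕ x
    q<x = ℕ.≤∧≢⇒< q≤x (x≢q ∘ sym)
    down-x : swapsDown j m ⟨$⟩ʳ x ≡ x
    down-x = trans (cong (swapsDown j m ⟨$⟩ʳ_) (sym (clamp-toℕ x)))
               (trans (swapsDown-above j m (toℕ x) (subst (_< toℕ x) (sym j+m≡q) q<x) (F.toℕ≤pred[n] x)) (clamp-toℕ x))
    down⁻¹-x : swapsDown j m ⟨$⟩ˡ x ≡ x
    down⁻¹-x = trans (cong (swapsDown j m ⟨$⟩ˡ_) (sym down-x)) (P.inverseˡ (swapsDown j m))

  SwapsThrough : ℕ → Set
  SwapsThrough q = ∀ π i → FixesFrom q π → suc i < q → n ⊢ permWord q π · sᵢ i ≈ permWord q (π ∘S swap i)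

  StepGoal : ℕ → Permutation′ n → ℕ → ℕ → ℕ → Set
  StepGoal q π j m i = n ⊢ permWordStep q π j m · sᵢ i ≈ permWord (suc q) (π ∘S swap i)

  swap-step-adjacent : ∀ q π i m → π ⟨$⟩ˡ pt q ≡ pt (suc i) → suc i + m ≡ q → q ≤ n-1 → StepGoal q π (suc i) m i
  swap-step-adjacent q π i m π⁻¹q≡ i+1+m≡q q≤ = ≈-trans (assoc _ _ _) (≡⇒≈ (sym (trans
      (permWord-unfold q (π ∘S swap i) i (suc m) preimage (trans (ℕ.+-suc i m) i+1+m≡q) q≤)
      (cong (_· sDown i (suc m)) (permWord-cong q (λ x → cong (π ⟨$⟩ʳ_) (P.inverseʳ (swap i))))))))
    where
    preimage : (π ∘S swap i) ⟨$⟩ˡ pt q ≡ pt i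
    preimage = trans (cong (swap i ⟨$⟩ˡ_) π⁻¹q≡)
                 (trans (transpose-inverse (pt i) (pt (suc i)) (pt (suc i))) (transpose-applyʳ (pt i) (pt (suc i))))

  swap-step-far : ∀ q π j m i → SwapsThrough q → π ⟨$⟩ˡ pt q ≡ pt j → j + m ≡ q → FixesFrom (suc q) π →
    q ≤ n-1 → suc i < j → StepGoal q π j m i
  swap-step-far q π j m i ih π⁻¹q≡j j+m≡q fixes q≤ i+1<j = begin
    (permWord q π' · sDown j m) · sᵢ i        ≈⟨ assoc _ _ _ ⟩
    permWord q π' · (sDown j m · sᵢ i)        ≈⟨ ∙-congˡ (≈-sym (sᵢ-commute-sDown i j m i+1<j j+m≤)) ⟩
    permWord q π' · (sᵢ i · sDown j m)        ≈⟨ ≈-sym (assoc _ _ _) ⟩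
    (permWord q π' · sᵢ i) · sDown j m        ≈⟨ ∙-congʳ (ih π' i (fixesFrom-peel q π j m fixes π⁻¹q≡j j+m≡q q≤) i+1<q) ⟩
    permWord q (π' ∘S swap i) · sDown j m     ≡⟨ sym (trans (permWord-unfold q (π ∘S swap i) j m preimage j+m≡q q≤)
                                                            (cong (_· sDown j m) (permWord-cong q reorder))) ⟩
    permWord (suc q) (π ∘S swap i)            ∎
    where
    π' : Permutation′ n
    π' = π ∘S P.flip (swapsDown j m)
    j+m≤ : j + m ≤ n-1
    j+m≤ = subst (_≤ n-1) (sym j+m≡q) q≤
    j≤ : j ≤ n-1
    j≤ = ℕ.≤-trans (ℕ.m≤m+n j m) j+m≤
    i+1<q : suc i < q
    i+1<q = ℕ.<-≤-trans i+1<j (subst (j ≤_) j+m≡q (ℕ.m≤m+n j m))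
    preimage : (π ∘S swap i) ⟨$⟩ˡ pt q ≡ pt j
    preimage = trans (cong (swap i ⟨$⟩ˡ_) π⁻¹q≡j) (trans (transpose-inverse (pt i) (pt (suc i)) (pt j))
                 (transpose-apply-≢ (pt-≢ j i j≤ (ℕ.≤-trans (ℕ.<⇒≤ (ℕ.<-trans (ℕ.n<1+n i) i+1<j)) j≤) (ℕ.>⇒≢ (ℕ.<-trans (ℕ.n<1+n i) i+1<j)))
                                    (pt-≢ j (suc i) j≤ (ℕ.≤-trans (ℕ.<⇒≤ i+1<j) j≤) (ℕ.>⇒≢ i+1<j))))
    reorder : ((π ∘S swap i) ∘S P.flip (swapsDown j m)) P.≈ (π' ∘S swap i)
    reorder x = cong (π ⟨$⟩ʳ_) (intertwine-inverse (swapsDown j m) (swap i) (swap i) (swapsDown-comm j m i i+1<j j+m≤) x)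

  swap-step-equal : ∀ q π j m → π ⟨$⟩ˡ pt q ≡ pt j → j + suc m ≡ q → q ≤ n-1 → StepGoal q π j (suc m) j
  swap-step-equal q π j m π⁻¹q≡j j+1+m≡q q≤ = begin
    (A · (B · sᵢ j)) · sᵢ j      ≈⟨ solve monoid ⟩
    A · (B · (sᵢ j · sᵢ j))      ≈⟨ ∙-congˡ (∙-congˡ (≈-trans (∙-congˡ (≈-sym (idʳ _))) (sᵢ-involutive j))) ⟩
    A · (B · e)                  ≈⟨ ∙-congˡ (idʳ B) ⟩
    A · B                        ≡⟨ sym (trans (permWord-unfold q (π ∘S swap j) (suc j) m preimage (trans (sym (ℕ.+-suc j m)) j+1+m≡q) q≤)
                                               (cong (_· B) (permWord-cong q reorder))) ⟩
    permWord (suc q) (π ∘S swap j) ∎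
    where
    A : Word
    A = permWord q (π ∘S P.flip (swapsDown (suc j) m ∘S swap j))
    B : Word
    B = sDown (suc j) m
    preimage : (π ∘S swap j) ⟨$⟩ˡ pt q ≡ pt (suc j)
    preimage = trans (cong (swap j ⟨$⟩ˡ_) π⁻¹q≡j) (trans (transpose-inverse (pt j) (pt (suc j)) (pt j)) (transpose-applyˡ (pt j) (pt (suc j))))
    reorder : ((π ∘S swap j) ∘S P.flip (swapsDown (suc j) m)) P.≈ (π ∘S P.flip (swapsDown (suc j) m ∘S swap j))
    reorder x = cong (π ⟨$⟩ʳ_) (sym (transpose-inverse (pt j) (pt (suc j)) (swapsDown (suc j) m ⟨$⟩ˡ x)))

  swap-step-above : ∀ q π j m i → SwapsThrough q → π ⟨$⟩ˡ pt q ≡ pt j → j + m ≡ q → FixesFrom (suc q) π →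
    q ≤ n-1 → j ≤ i → suc i < q → StepGoal q π j m (suc i)
  swap-step-above q π j m i ih π⁻¹q≡j j+m≡q fixes q≤ j≤i i+1<q = begin
    (permWord q π' · sDown j m) · sᵢ (suc i)  ≈⟨ assoc _ _ _ ⟩
    permWord q π' · (sDown j m · sᵢ (suc i))  ≈⟨ ∙-congˡ (sDown-shift j m i j≤i i+2≤ j+m≤) ⟩
    permWord q π' · (sᵢ i · sDown j m)        ≈⟨ ≈-sym (assoc _ _ _) ⟩
    (permWord q π' · sᵢ i) · sDown j m        ≈⟨ ∙-congʳ (ih π' i (fixesFrom-peel q π j m fixes π⁻¹q≡j j+m≡q q≤) i+1<q) ⟩
    permWord q (π' ∘S swap i) · sDown j m     ≡⟨ sym (trans (permWord-unfold q (π ∘S swap (suc i)) j m preimage j+m≡q q≤)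
                                                            (cong (_· sDown j m) (permWord-cong q reorder))) ⟩
    permWord (suc q) (π ∘S swap (suc i))      ∎
    where
    π' : Permutation′ n
    π' = π ∘S P.flip (swapsDown j m)
    j+m≤ : j + m ≤ n-1
    j+m≤ = subst (_≤ n-1) (sym j+m≡q) q≤
    i+2≤ : suc (suc i) ≤ j + m
    i+2≤ = subst (suc (suc i) ≤_) (sym j+m≡q) i+1<q
    i+2≤n-1 : suc (suc i) ≤ n-1
    i+2≤n-1 = ℕ.≤-trans i+2≤ j+m≤
    j≤ : j ≤ n-1
    j≤ = ℕ.≤-trans (ℕ.m≤m+n j m) j+m≤
    preimage : (π ∘S swap (suc i)) ⟨$⟩ˡ pt q ≡ pt j
    preimage = trans (cong (swap (suc i) ⟨$⟩ˡ_) π⁻¹q≡j) (trans (transpose-inverse (pt (suc i)) (pt (suc (suc i))) (pt j))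
                 (transpose-apply-≢ (pt-≢ j (suc i) j≤ (ℕ.≤-trans (ℕ.n≤1+n _) i+2≤n-1) (ℕ.<⇒≢ (s≤s j≤i)))
                                    (pt-≢ j (suc (suc i)) j≤ i+2≤n-1 (ℕ.<⇒≢ (ℕ.<-trans (s≤s j≤i) (ℕ.n<1+n _))))))
    reorder : ((π ∘S swap (suc i)) ∘S P.flip (swapsDown j m)) P.≈ (π' ∘S swap i)
    reorder x = cong (π ⟨$⟩ʳ_) (intertwine-inverse (swapsDown j m) (swap (suc i)) (swap i) (swapsDown-shift j m i j≤i i+2≤ j+m≤) x)

  swap-step : ∀ q π j m i → SwapsThrough q → π ⟨$⟩ˡ pt q ≡ pt j → j + m ≡ q → FixesFrom (suc q) π →
    q ≤ n-1 → i < q → StepGoal q π j m i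
  swap-step q π j m i ih π⁻¹q≡j j+m≡q fixes q≤ i<q with ℕ.<-cmp i j
  ... | tri< i<j _ _ with suc i ℕ.≟ j
  ...   | yes refl = swap-step-adjacent q π i m π⁻¹q≡j j+m≡q q≤
  ...   | no i+1≢j = swap-step-far q π j m i ih π⁻¹q≡j j+m≡q fixes q≤ (ℕ.≤∧≢⇒< i<j i+1≢j)
  swap-step q π j (suc m) .j ih π⁻¹q≡j j+m≡q fixes q≤ i<q | tri≈ _ refl _ = swap-step-equal q π j m π⁻¹q≡j j+m≡q q≤
  swap-step q π j zero .j ih π⁻¹q≡j j+0≡q fixes q≤ j<q | tri≈ _ refl _ =
    ⊥-elim (ℕ.<-irrefl (trans (sym (ℕ.+-identityʳ j)) j+0≡q) j<q)
  swap-step q π j m zero ih π⁻¹q≡j j+m≡q fixes q≤ i<q | tri> _ _ ()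
  swap-step q π j m (suc i) ih π⁻¹q≡j j+m≡q fixes q≤ i+1<q | tri> _ _ j<i+1 =
    swap-step-above q π j m i ih π⁻¹q≡j j+m≡q fixes q≤ (ℕ.≤-pred j<i+1) i+1<q

  permWord-swap : ∀ q → q ≤ n → SwapsThrough q
  permWord-swap zero _ π i fixes ()
  permWord-swap (suc q) (s≤s q≤) π i fixes (s≤s i<q) =
    swap-step q π j (q ∸ j) i (permWord-swap q (ℕ.m≤n⇒m≤1+n q≤)) (sym (clamp-toℕ _))
      (ℕ.m+[n∸m]≡n (preimageIndex-≤ q π fixes q≤)) fixes q≤ i<q
    where
    j : ℕ
    j = preimageIndex q π

  eval-permWord : ∀ q π → FixesFrom q π → q ≤ n → eval (permWord q π) ≋ permElt π
  eval-permWord zero π fixes _ = mk ((λ _ → refl) , (λ x → sym (fixes x z≤n)))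
  eval-permWord (suc q) π fixes (s≤s q≤) =
    SD.trans (SD.∙-cong {eval (permWord q π')} {permElt π'} {eval (sDown j m)} {permElt (swapsDown j m)}
                (eval-permWord q π' (fixesFrom-peel q π j m fixes (sym (clamp-toℕ _)) j+m≡q q≤) (ℕ.m≤n⇒m≤1+n q≤))
                (eval-sDown j m (subst (_≤ n-1) (sym j+m≡q) q≤)))
             (mk ((λ _ → refl) , (λ x → cong (π ⟨$⟩ʳ_) (P.inverseˡ (swapsDown j m)))))
    where
    j : ℕ
    j = preimageIndex q π
    m : ℕ
    m = q ∸ j
    π' : Permutation′ n
    π' = π ∘S P.flip (swapsDown j m)
    j+m≡q : j + m ≡ q
    j+m≡q = ℕ.m+[n∸m]≡n (preimageIndex-≤ q π fixes q≤)

  permWord-id : ∀ q → q ≤ n → n ⊢ permWord q P.id ≈ e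
  permWord-id zero _ = ≈-refl
  permWord-id (suc q) (s≤s q≤) = begin
    permWord (suc q) P.id                      ≡⟨ permWord-unfold q P.id q 0 refl (ℕ.+-identityʳ q) q≤ ⟩
    permWord q (P.id ∘S P.flip P.id) · e       ≈⟨ idʳ _ ⟩
    permWord q (P.id ∘S P.flip P.id)           ≡⟨ permWord-cong q (λ _ → refl) ⟩
    permWord q P.id                            ≈⟨ permWord-id q (ℕ.m≤n⇒m≤1+n q≤) ⟩
    e                                          ∎

  -- Opaque for the same reason as cycle.
  opaque
    wordOf : Permutation′ n → Word
    wordOf π = permWord n π

    wordOf≡ : ∀ π → wordOf π ≡ permWord n π
    wordOf≡ π = refl

  fixesFrom-n : ∀ π → FixesFrom n π
  fixesFrom-n π x n≤x = ⊥-elim (ℕ.<-irrefl refl (ℕ.≤-trans (F.toℕ<n x) n≤x))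

  wordOf-cong : ∀ {π ρ} → π P.≈ ρ → n ⊢ wordOf π ≈ wordOf ρ
  wordOf-cong {π} {ρ} eq = ≡⇒≈ (trans (wordOf≡ π) (trans (permWord-cong n {π} {ρ} eq) (sym (wordOf≡ ρ))))

  wordOf-sᵢ : ∀ π i → i < n-1 → n ⊢ wordOf π · sᵢ i ≈ wordOf (π ∘S swap i)
  wordOf-sᵢ π i i< = begin
    wordOf π · sᵢ i              ≡⟨ cong (_· sᵢ i) (wordOf≡ π) ⟩
    permWord n π · sᵢ i          ≈⟨ permWord-swap n ℕ.≤-refl π i (fixesFrom-n π) (s≤s i<) ⟩
    permWord n (π ∘S swap i)     ≡⟨ sym (wordOf≡ (π ∘S swap i)) ⟩
    wordOf (π ∘S swap i)         ∎

  wordOf-id : n ⊢ wordOf P.id ≈ e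
  wordOf-id = ≈-trans (≡⇒≈ (wordOf≡ P.id)) (permWord-id n ℕ.≤-refl)

  eval-wordOf : ∀ π → eval (wordOf π) ≋ permElt π
  eval-wordOf π = subst (λ w → eval w ≋ permElt π) (sym (wordOf≡ π)) (eval-permWord n π (fixesFrom-n π) ℕ.≤-refl)

  data GammaFree : Word → Set where
    s-free : GammaFree s
    t-free : GammaFree t
    e-free : GammaFree e
    ·-free : ∀ {a b} → GammaFree a → GammaFree b → GammaFree (a · b)
    ⁻¹-free : ∀ {a} → GammaFree a → GammaFree (a ⁻¹)

  gammaFree-^ : ∀ {a} m → GammaFree a → GammaFree (a ^ m)
  gammaFree-^ zero _ = e-free
  gammaFree-^ (suc m) a-free = ·-free a-free (gammaFree-^ m a-free)

  gammaFree-sᵢ : ∀ i → GammaFree (sᵢ i)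
  gammaFree-sᵢ i = ·-free (·-free (gammaFree-^ i t-free) s-free) (⁻¹-free (gammaFree-^ i t-free))

  gammaFree-sDown : ∀ j m → GammaFree (sDown j m)
  gammaFree-sDown j zero = e-free
  gammaFree-sDown j (suc m) = ·-free (gammaFree-sDown (suc j) m) (gammaFree-sᵢ j)

  gammaFree-permWord : ∀ q π → GammaFree (permWord q π)
  gammaFree-permWord zero π = e-free
  gammaFree-permWord (suc q) π = ·-free (gammaFree-permWord q _) (gammaFree-sDown _ _)

  gammaFree-wordOf : ∀ π → GammaFree (wordOf π)
  gammaFree-wordOf π = subst GammaFree (sym (wordOf≡ π)) (gammaFree-permWord n π)

  wordOf-sUp : ∀ j m → j + m ≤ n-1 → ∀ α → n ⊢ wordOf α · conjProduct s t j m ≈ wordOf (α ∘S perm (conjProduct s t j m))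
  wordOf-sUp j zero le α = ≈-trans (idʳ _) (wordOf-cong (λ _ → refl))
  wordOf-sUp j (suc m) le α = begin
    wordOf α · (sᵢ j · U)                    ≈⟨ ≈-sym (assoc _ _ _) ⟩
    (wordOf α · sᵢ j) · U                    ≈⟨ ∙-congʳ (wordOf-sᵢ α j j<) ⟩
    wordOf (α ∘S swap j) · U                 ≈⟨ wordOf-sUp (suc j) m (+-suc-≤ le) (α ∘S swap j) ⟩
    wordOf ((α ∘S swap j) ∘S perm U)         ≈⟨ wordOf-cong (λ x → cong (α ⟨$⟩ʳ_) (sym (perm-sᵢ j j< _))) ⟩
    wordOf (α ∘S perm (sᵢ j · U))            ∎
    where
    U : Word
    U = conjProduct s t (suc j) m
    j< : j < n-1
    j< = ℕ.<-≤-trans (ℕ.m<m+n j (s≤s z≤n)) le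

  wordOf-∙-gammaFree : ∀ {u} → GammaFree u → ∀ α → n ⊢ wordOf α · u ≈ wordOf (α ∘S perm u)
  wordOf-∙-gammaFree s-free α = ≈-trans (∙-congˡ (≈-sym (conj-identity s))) (wordOf-sᵢ α 0 (s≤s z≤n))
  wordOf-∙-gammaFree t-free α = begin
    wordOf α · t                                 ≈⟨ ∙-congˡ t≈sUp ⟩
    wordOf α · conjProduct s t 0 n-1             ≈⟨ wordOf-sUp 0 n-1 ℕ.≤-refl α ⟩
    wordOf (α ∘S perm (conjProduct s t 0 n-1))   ≈⟨ wordOf-cong (λ x → cong (α ⟨$⟩ʳ_) (sym (perm-≈ t≈sUp x))) ⟩
    wordOf (α ∘S perm t)                         ∎
  wordOf-∙-gammaFree e-free α = ≈-trans (idʳ _) (wordOf-cong (λ _ → refl))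
  wordOf-∙-gammaFree (·-free {a} {b} a-free b-free) α = begin
    wordOf α · (a · b)                  ≈⟨ ≈-sym (assoc _ _ _) ⟩
    (wordOf α · a) · b                  ≈⟨ ∙-congʳ (wordOf-∙-gammaFree a-free α) ⟩
    wordOf (α ∘S perm a) · b            ≈⟨ wordOf-∙-gammaFree b-free _ ⟩
    wordOf ((α ∘S perm a) ∘S perm b)    ≈⟨ wordOf-cong (λ _ → refl) ⟩
    wordOf (α ∘S perm (a · b))          ∎
  wordOf-∙-gammaFree (⁻¹-free {a} a-free) α = begin
    wordOf α · a ⁻¹             ≈⟨ ∙-congʳ (wordOf-cong (λ x → cong (α ⟨$⟩ʳ_) (sym (P.inverseˡ (perm a))))) ⟩
    wordOf (β ∘S perm a) · a ⁻¹ ≈⟨ ∙-congʳ (≈-sym (wordOf-∙-gammaFree a-free β)) ⟩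
    (wordOf β · a) · a ⁻¹       ≈⟨ assoc _ _ _ ⟩
    wordOf β · (a · a ⁻¹)       ≈⟨ ∙-congˡ (invʳ a) ⟩
    wordOf β · e                ≈⟨ idʳ _ ⟩
    wordOf β                    ∎
    where
    β : Permutation′ n
    β = α ∘S perm (a ⁻¹)

  gammaFree≈wordOf : ∀ {u} → GammaFree u → n ⊢ u ≈ wordOf (perm u)
  gammaFree≈wordOf {u} u-free = begin
    u                          ≈⟨ ≈-sym (idˡ u) ⟩
    e · u                      ≈⟨ ∙-congʳ (≈-sym wordOf-id) ⟩
    wordOf P.id · u            ≈⟨ wordOf-∙-gammaFree u-free P.id ⟩
    wordOf (P.id ∘S perm u)    ≈⟨ wordOf-cong (λ _ → refl) ⟩
    wordOf (perm u)            ∎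

  wordOf-∙ : ∀ α β → n ⊢ wordOf α · wordOf β ≈ wordOf (α ∘S β)
  wordOf-∙ α β = ≈-trans (wordOf-∙-gammaFree (gammaFree-wordOf β) α)
                         (wordOf-cong {α ∘S perm (wordOf β)} {α ∘S β} (λ x → cong (α ⟨$⟩ʳ_) (proj₂ (get (eval-wordOf β)) x)))

  -- The conjugates of γ

  γ-commute-sᵢ : ∀ j → j ≤ n ∸ 3 → Commute g (sᵢ j)
  γ-commute-sᵢ j j≤ = subst (λ w → n ⊢ g · w ≈ w · g) (conjT≡conj j s) (rel₅ j j≤)

  γ-commute-sDown : ∀ j m → j + m ≤ n ∸ 2 → Commute g (sDown j m)
  γ-commute-sDown j zero le = commute-ε g
  γ-commute-sDown j (suc m) le =
    commute-∙ (γ-commute-sDown (suc j) m (+-suc-≤ le)) (γ-commute-sᵢ j (ℕ.≤-pred (ℕ.<-≤-trans (ℕ.m<m+n j (s≤s z≤n)) le)))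

  γ-commute-permWord : ∀ q π → q ≤ n-1 → Commute g (permWord q π)
  γ-commute-permWord zero π _ = commute-ε g
  γ-commute-permWord (suc q) π (s≤s q≤) =
    commute-∙ (γ-commute-permWord q _ (ℕ.m≤n⇒m≤1+n q≤)) (γ-commute-sDown-to q (preimageIndex q π) q≤)
    where
    γ-commute-sDown-to : ∀ r j → r ≤ n ∸ 2 → Commute g (sDown j (r ∸ j))
    γ-commute-sDown-to r j r≤ with j ℕ.≤? r
    ... | yes j≤r = γ-commute-sDown j (r ∸ j) (subst (_≤ n ∸ 2) (sym (ℕ.m+[n∸m]≡n j≤r)) r≤)
    ... | no j≰r rewrite ℕ.m≤n⇒m∸n≡0 (ℕ.<⇒≤ (ℕ.≰⇒> j≰r)) = commute-ε g

  γ-commute-wordOf : ∀ π → π ⟨$⟩ʳ pt n-1 ≡ pt n-1 → Commute g (wordOf π)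
  γ-commute-wordOf π fixes = subst (Commute g) (sym wordOf≡permWord)
    (commute-∙ (γ-commute-permWord n-1 (π ∘S P.flip P.id) ℕ.≤-refl) (commute-ε g))
    where
    wordOf≡permWord : wordOf π ≡ permWord n-1 (π ∘S P.flip P.id) · e
    wordOf≡permWord = trans (wordOf≡ π) (permWord-unfold n-1 π n-1 0
      (trans (cong (π ⟨$⟩ˡ_) (sym fixes)) (P.inverseˡ π)) (ℕ.+-identityʳ n-1) ℕ.≤-refl)

  toTop : Fin n → Permutation′ n
  toTop x = P.flip (swapsDown (toℕ x) (n-1 ∸ toℕ x))

  toTop-top : ∀ x → toTop x ⟨$⟩ʳ pt n-1 ≡ x
  toTop-top x = trans (cong (swapsDown j (n-1 ∸ j) ⟨$⟩ˡ_) (sym (trans (swapsDown-start j (n-1 ∸ j) (ℕ.≤-reflexive j+m≡)) (cong pt j+m≡))))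
                      (trans (P.inverseˡ (swapsDown j (n-1 ∸ j))) (clamp-toℕ x))
    where
    j : ℕ
    j = toℕ x
    j+m≡ : j + (n-1 ∸ j) ≡ n-1
    j+m≡ = ℕ.m+[n∸m]≡n (F.toℕ≤pred[n] x)

  γAt : Fin n → Word
  γAt x = conj (wordOf (toTop x)) g

  eval-γAt : ∀ x → eval (γAt x) ≋ (single x 1ℤ , P.id)
  eval-γAt x = SD.trans (SD.∙-cong {eval (wordOf (toTop x)) *SD eval g} {permElt (toTop x) *SD eval g}
                                   {invSD (eval (wordOf (toTop x)))} {invSD (permElt (toTop x))}
                                   (SD.∙-congʳ {eval g} (eval-wordOf (toTop x))) (SD.⁻¹-cong (eval-wordOf (toTop x))))
    (mk ((λ i → trans (ℤ.+-identityʳ _) (trans (ℤ.+-identityˡ _)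
                  (trans (single-⟨$⟩ˡ (toTop x) (pt n-1) 1ℤ i) (cong (λ y → single y 1ℤ i) (toTop-top x))))) ,
         (λ i → P.inverseʳ (toTop x))))

  perm-t^ : ∀ l → perm (t ^ l) ≡ cycle ^ₚ l
  perm-t^ l = cong proj₂ (trans (eval-^ t l) (permElt-^ cycle l))

  γ-commute-conj : ∀ {U} → GammaFree U → perm U ⟨$⟩ʳ pt n-1 ≢ pt n-1 → Commute g (conj U g)
  γ-commute-conj {U} U-free moves = begin
    g · conj U g          ≈⟨ ∙-congˡ conj≈ ⟩
    g · conj (t ^ l) g    ≈⟨ subst (λ w → n ⊢ g · w ≈ w · g) (conjT≡conj l g) (rel₆ l (s≤s z≤n) l≤) ⟩
    conj (t ^ l) g · g    ≈⟨ ∙-congʳ (≈-sym conj≈) ⟩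
    conj U g · g          ∎
    where
    z : Fin n
    z = perm U ⟨$⟩ʳ pt n-1
    l-1 : ℕ
    l-1 = toℕ z
    l : ℕ
    l = suc l-1
    l-1<n-1 : l-1 < n-1
    l-1<n-1 = ℕ.≤∧≢⇒< (F.toℕ≤pred[n] z) (λ eq → moves (trans (sym (clamp-toℕ z)) (cong pt eq)))
    l≤ : l ≤ n ∸ 1
    l≤ = l-1<n-1
    C : Permutation′ n
    C = perm (t ^ l)
    C-top : C ⟨$⟩ʳ pt n-1 ≡ z
    C-top = trans (cong (λ c → c ⟨$⟩ʳ pt n-1) (perm-t^ l))
             (trans (^ₚ-sucʳ cycle l-1 (pt n-1))
               (trans (cong (cycle ^ₚ l-1 ⟨$⟩ʳ_) cycle-top)
                 (trans (cycle^ l-1 0 (subst (_≤ n-1) (sym (ℕ.+-identityʳ l-1)) (ℕ.<⇒≤ l-1<n-1)))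
                   (trans (cong pt (ℕ.+-identityʳ l-1)) (clamp-toℕ z)))))
    R : Word
    R = wordOf (P.flip C ∘S perm U)
    R-fixes : (P.flip C ∘S perm U) ⟨$⟩ʳ pt n-1 ≡ pt n-1
    R-fixes = trans (cong (C ⟨$⟩ˡ_) (sym C-top)) (P.inverseˡ C)
    U≈ : n ⊢ U ≈ t ^ l · R
    U≈ = begin
      U                                ≈⟨ gammaFree≈wordOf U-free ⟩
      wordOf (perm U)                  ≈⟨ wordOf-cong (λ x → sym (P.inverseʳ C)) ⟩
      wordOf (C ∘S (P.flip C ∘S perm U)) ≈⟨ ≈-sym (wordOf-∙ C _) ⟩
      wordOf C · R                     ≈⟨ ∙-congʳ (≈-sym (gammaFree≈wordOf (gammaFree-^ l t-free))) ⟩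
      t ^ l · R                        ∎
    conj≈ : n ⊢ conj U g ≈ conj (t ^ l) g
    conj≈ = begin
      conj U g                ≈⟨ conj-congˡ g U≈ ⟩
      conj (t ^ l · R) g      ≈⟨ ≈-sym (conj-conj (t ^ l) R g) ⟩
      conj (t ^ l) (conj R g) ≈⟨ conj-congʳ (t ^ l) (commute⇒conj≈ (γ-commute-wordOf _ R-fixes)) ⟩
      conj (t ^ l) g          ∎

  wordOf-γ : ∀ π → n ⊢ wordOf π · g ≈ γAt (π ⟨$⟩ʳ pt n-1) · wordOf π
  wordOf-γ π = begin
    wordOf π · g                         ≈⟨ ∙-congʳ π≈WyWrest ⟩
    (Wy · Wrest) · g                     ≈⟨ assoc _ _ _ ⟩
    Wy · (Wrest · g)                     ≈⟨ ∙-congˡ (≈-sym (γ-commute-wordOf _ rest-fixes)) ⟩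
    Wy · (g · Wrest)                     ≈⟨ solve monoid ⟩
    (Wy · g) · (e · Wrest)               ≈⟨ ∙-congˡ (∙-congʳ (≈-sym (invˡ Wy))) ⟩
    (Wy · g) · ((Wy ⁻¹ · Wy) · Wrest)    ≈⟨ solve monoid ⟩
    ((Wy · g) · Wy ⁻¹) · (Wy · Wrest)    ≈⟨ ∙-congˡ (≈-sym π≈WyWrest) ⟩
    γAt y · wordOf π                     ∎
    where
    y : Fin n
    y = π ⟨$⟩ʳ pt n-1
    Wy : Word
    Wy = wordOf (toTop y)
    Wrest : Word
    Wrest = wordOf (P.flip (toTop y) ∘S π)
    π≈WyWrest : n ⊢ wordOf π ≈ Wy · Wrest
    π≈WyWrest = ≈-trans (wordOf-cong (λ x → sym (P.inverseʳ (toTop y)))) (≈-sym (wordOf-∙ (toTop y) _))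
    rest-fixes : (P.flip (toTop y) ∘S π) ⟨$⟩ʳ pt n-1 ≡ pt n-1
    rest-fixes = trans (cong (toTop y ⟨$⟩ˡ_) (sym (toTop-top y))) (P.inverseˡ (toTop y))

  γAt-commute : ∀ x y → Commute (γAt x) (γAt y)
  γAt-commute x y with x F.≟ y
  ... | yes refl = ≈-refl
  ... | no x≢y = begin
    γAt x · γAt y                       ≈⟨ ∙-congʳ γAt-x≈ ⟩
    conj Py (conj U g) · conj Py g      ≈⟨ ≈-sym (conj-∙ Py _ _) ⟩
    conj Py (conj U g · g)              ≈⟨ conj-congʳ Py (≈-sym (γ-commute-conj (gammaFree-wordOf _) moves)) ⟩
    conj Py (g · conj U g)              ≈⟨ conj-∙ Py _ _ ⟩
    conj Py g · conj Py (conj U g)      ≈⟨ ∙-congˡ (≈-sym γAt-x≈) ⟩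
    γAt y · γAt x                       ∎
    where
    Py : Word
    Py = wordOf (toTop y)
    α : Permutation′ n
    α = P.flip (toTop y) ∘S toTop x
    U : Word
    U = wordOf α
    γAt-x≈ : n ⊢ γAt x ≈ conj Py (conj U g)
    γAt-x≈ = begin
      conj (wordOf (toTop x)) g         ≈⟨ conj-congˡ g (wordOf-cong (λ _ → sym (P.inverseʳ (toTop y)))) ⟩
      conj (wordOf (toTop y ∘S α)) g    ≈⟨ conj-congˡ g (≈-sym (wordOf-∙ (toTop y) α)) ⟩
      conj (Py · U) g                   ≈⟨ ≈-sym (conj-conj Py U g) ⟩
      conj Py (conj U g)                ∎
    moves : perm U ⟨$⟩ʳ pt n-1 ≢ pt n-1
    moves eq = x≢y (trans (sym (toTop-top x)) (trans (sym (P.inverseʳ (toTop y)))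
                 (trans (cong (toTop y ⟨$⟩ʳ_) (trans (sym (proj₂ (get (eval-wordOf α)) (pt n-1))) eq)) (toTop-top y))))

  -- Normal forms of all words

  vecWord : (Fin n → ℤ) → ℕ → Word
  vecWord v zero = e
  vecWord v (suc r) = vecWord v r · γAt (pt r) ^ℤ v (pt r)

  vecWord-cong : ∀ v w r → (∀ i → i < r → v (pt i) ≡ w (pt i)) → vecWord v r ≡ vecWord w r
  vecWord-cong v w zero _ = refl
  vecWord-cong v w (suc r) v≡w =
    cong₂ (λ a z → a · γAt (pt r) ^ℤ z) (vecWord-cong v w r (λ i i<r → v≡w i (ℕ.m<n⇒m<1+n i<r))) (v≡w r (ℕ.n<1+n r))

  addUnit : (Fin n → ℤ) → Fin n → Fin n → ℤ
  addUnit v x i = v i +ℤ single x 1ℤ i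

  addUnit-≢ : ∀ v {x i} → i ≢ x → v i ≡ addUnit v x i
  addUnit-≢ v {i = i} i≢x = sym (trans (cong (v i +ℤ_) (single-≢ 1ℤ i≢x)) (ℤ.+-identityʳ _))

  vecWord-γAt : ∀ v x r → toℕ x < r → r ≤ n → n ⊢ vecWord v r · γAt x ≈ vecWord (addUnit v x) r
  vecWord-γAt v x (suc r) (s≤s x≤r) r< with toℕ x ℕ.≟ r
  ... | yes x≡r = begin
    (vecWord v r · γAt (pt r) ^ℤ v (pt r)) · γAt x   ≡⟨ cong (λ y → (vecWord v r · γAt y ^ℤ v y) · γAt x) (sym x≡pt) ⟩
    (vecWord v r · γAt x ^ℤ v x) · γAt x             ≈⟨ assoc _ _ _ ⟩
    vecWord v r · (γAt x ^ℤ v x · γAt x)             ≈⟨ ∙-congˡ (^ℤ-sucʳ (γAt x) (v x)) ⟩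
    vecWord v r · γAt x ^ℤ (v x +ℤ 1ℤ)               ≡⟨ cong₂ (λ a z → a · γAt x ^ℤ z) (vecWord-cong v (addUnit v x) r below)
                                                             (cong (v x +ℤ_) (sym (single-≡ x 1ℤ))) ⟩
    vecWord (addUnit v x) r · γAt x ^ℤ addUnit v x x ≡⟨ cong (λ y → vecWord (addUnit v x) r · γAt y ^ℤ addUnit v x y) x≡pt ⟩
    vecWord (addUnit v x) (suc r)                    ∎
    where
    x≡pt : x ≡ pt r
    x≡pt = trans (sym (clamp-toℕ x)) (cong pt x≡r)
    below : ∀ i → i < r → v (pt i) ≡ addUnit v x (pt i)
    below i i<r = addUnit-≢ v (λ eq → ℕ.<-irrefl (trans (sym (toℕ-clamp i (ℕ.≤-trans (ℕ.<⇒≤ i<r) (ℕ.≤-pred r<)))) (trans (cong toℕ eq) x≡r)) i<r)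
  ... | no x≢r = begin
    (vecWord v r · Γ) · γAt x                 ≈⟨ assoc _ _ _ ⟩
    vecWord v r · (Γ · γAt x)                 ≈⟨ ∙-congˡ (≈-sym (commute-^ℤ (v (pt r)) (γAt-commute x (pt r)))) ⟩
    vecWord v r · (γAt x · Γ)                 ≈⟨ ≈-sym (assoc _ _ _) ⟩
    (vecWord v r · γAt x) · Γ                 ≈⟨ ∙-congʳ (vecWord-γAt v x r (ℕ.≤∧≢⇒< x≤r x≢r) (ℕ.m≤n⇒m≤1+n (ℕ.≤-pred r<))) ⟩
    vecWord (addUnit v x) r · Γ               ≡⟨ cong (λ z → vecWord (addUnit v x) r · γAt (pt r) ^ℤ z) (addUnit-≢ v pt-r≢x) ⟩
    vecWord (addUnit v x) (suc r)             ∎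
    where
    Γ : Word
    Γ = γAt (pt r) ^ℤ v (pt r)
    pt-r≢x : pt r ≢ x
    pt-r≢x eq = x≢r (trans (sym (cong toℕ eq)) (toℕ-clamp r (ℕ.≤-pred r<)))

  eval-γAt-^ : ∀ x m → eval (γAt x ^ m) ≋ (single x (+ m) , P.id)
  eval-γAt-^ x zero = mk ((λ i → sym (single-0 x i)) , (λ _ → refl))
  eval-γAt-^ x (suc m) =
    SD.trans (SD.∙-cong {eval (γAt x)} {single x 1ℤ , P.id} {eval (γAt x ^ m)} {single x (+ m) , P.id}
                        (eval-γAt x) (eval-γAt-^ x m))
             (mk ((λ i → single-+ x 1ℤ (+ m) i) , (λ _ → refl)))

  eval-γAt⁻¹-^ : ∀ x m → eval ((γAt x ⁻¹) ^ m) ≋ (single x (-ℤ (+ m)) , P.id)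
  eval-γAt⁻¹-^ x zero = mk ((λ i → sym (single-0 x i)) , (λ _ → refl))
  eval-γAt⁻¹-^ x (suc m) =
    SD.trans (SD.∙-cong {eval (γAt x ⁻¹)} {single x (-ℤ 1ℤ) , P.id} {eval ((γAt x ⁻¹) ^ m)} {single x (-ℤ (+ m)) , P.id}
                        (SD.trans (SD.⁻¹-cong (eval-γAt x)) (mk ((λ i → single-neg x 1ℤ i) , (λ _ → refl))))
                        (eval-γAt⁻¹-^ x m))
             (mk ((λ i → trans (single-+ x (-ℤ 1ℤ) (-ℤ (+ m)) i) (cong (λ z → single x z i) (neg-suc m))) , (λ _ → refl)))
    where
    neg-suc : ∀ m → -ℤ 1ℤ +ℤ -ℤ (+ m) ≡ -ℤ (+ suc m)
    neg-suc zero = refl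
    neg-suc (suc m) = refl

  eval-γAt-^ℤ : ∀ x z → eval (γAt x ^ℤ z) ≋ (single x z , P.id)
  eval-γAt-^ℤ x (+ m) = eval-γAt-^ x m
  eval-γAt-^ℤ x -[1+ m ] = eval-γAt⁻¹-^ x (suc m)

  vecPrefix : (Fin n → ℤ) → ℕ → Fin n → ℤ
  vecPrefix v zero i = 0ℤ
  vecPrefix v (suc r) i = vecPrefix v r i +ℤ single (pt r) (v (pt r)) i

  eval-vecWord : ∀ v r → eval (vecWord v r) ≋ (vecPrefix v r , P.id)
  eval-vecWord v zero = SD.refl
  eval-vecWord v (suc r) =
    SD.∙-cong {eval (vecWord v r)} {vecPrefix v r , P.id} {eval (γAt (pt r) ^ℤ v (pt r))} {single (pt r) (v (pt r)) , P.id}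
              (eval-vecWord v r) (eval-γAt-^ℤ (pt r) (v (pt r)))

  vecPrefix-above : ∀ v r i → r ≤ toℕ i → vecPrefix v r i ≡ 0ℤ
  vecPrefix-above v zero i _ = refl
  vecPrefix-above v (suc r) i r<i =
    trans (cong (_+ℤ single (pt r) (v (pt r)) i) (vecPrefix-above v r i (ℕ.≤-trans (ℕ.n≤1+n r) r<i)))
          (trans (ℤ.+-identityˡ _) (single-≢ (v (pt r)) i≢pt-r))
    where
    i≢pt-r : i ≢ pt r
    i≢pt-r eq = ℕ.<-irrefl (sym (trans (cong toℕ eq) (toℕ-clamp r (ℕ.≤-trans (ℕ.n≤1+n r) (ℕ.≤-trans r<i (F.toℕ≤pred[n] i)))))) r<i

  vecPrefix-below : ∀ v r i → toℕ i < r → r ≤ n → vecPrefix v r i ≡ v i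
  vecPrefix-below v (suc r) i (s≤s i≤r) r< with toℕ i ℕ.≟ r
  ... | yes i≡r = trans (cong₂ _+ℤ_ (vecPrefix-above v r i (ℕ.≤-reflexive (sym i≡r)))
                                     (trans (cong (single (pt r) (v (pt r))) i≡pt) (single-≡ (pt r) _)))
                        (trans (ℤ.+-identityˡ _) (cong v (sym i≡pt)))
    where
    i≡pt : i ≡ pt r
    i≡pt = trans (sym (clamp-toℕ i)) (cong pt i≡r)
  ... | no i≢r = trans (cong₂ _+ℤ_ (vecPrefix-below v r i (ℕ.≤∧≢⇒< i≤r i≢r) (ℕ.m≤n⇒m≤1+n (ℕ.≤-pred r<)))
                                   (single-≢ _ (λ eq → i≢r (trans (cong toℕ eq) (toℕ-clamp r (ℕ.≤-pred r<))))))
                   (ℤ.+-identityʳ _)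

  normalForm : SD n → Word
  normalForm (v , π) = vecWord v n · wordOf π

  normalForm-cong : ∀ {x y} → x ≋ y → n ⊢ normalForm x ≈ normalForm y
  normalForm-cong {v , π} {w , ρ} (mk (v≡w , π≈ρ)) =
    ·-cong (≡⇒≈ (vecWord-cong v w n (λ i _ → v≡w (pt i)))) (wordOf-cong π≈ρ)

  eval-normalForm : ∀ y → eval (normalForm y) ≋ y
  eval-normalForm (v , π) =
    SD.trans (SD.∙-cong {eval (vecWord v n)} {vecPrefix v n , P.id} {eval (wordOf π)} {permElt π}
                        (eval-vecWord v n) (eval-wordOf π))
             (mk ((λ i → trans (ℤ.+-identityʳ _) (vecPrefix-below v n i (F.toℕ<n i) ℕ.≤-refl)) , (λ _ → refl)))

  normalForm-∙-gammaFree : ∀ v π {u} → GammaFree u → n ⊢ normalForm (v , π) · u ≈ normalForm ((v , π) *SD permElt (perm u))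
  normalForm-∙-gammaFree v π {u} u-free = begin
    (vecWord v n · wordOf π) · u          ≈⟨ assoc _ _ _ ⟩
    vecWord v n · (wordOf π · u)          ≈⟨ ∙-congˡ (wordOf-∙-gammaFree u-free π) ⟩
    vecWord v n · wordOf (π ∘S perm u)    ≈⟨ normalForm-cong (mk ((λ i → sym (ℤ.+-identityʳ (v i))) , (λ _ → refl))) ⟩
    normalForm ((v , π) *SD permElt (perm u)) ∎

  normalForm-∙-gen : ∀ x y → n ⊢ normalForm y · gen x ≈ normalForm (y *SD eval (gen x))
  normalForm-∙-gen σ (v , π) = normalForm-∙-gammaFree v π s-free
  normalForm-∙-gen τ (v , π) = normalForm-∙-gammaFree v π t-free
  normalForm-∙-gen γ (v , π) = begin
    (vecWord v n · wordOf π) · g          ≈⟨ assoc _ _ _ ⟩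
    vecWord v n · (wordOf π · g)          ≈⟨ ∙-congˡ (wordOf-γ π) ⟩
    vecWord v n · (γAt y · wordOf π)      ≈⟨ ≈-sym (assoc _ _ _) ⟩
    (vecWord v n · γAt y) · wordOf π      ≈⟨ ∙-congʳ (vecWord-γAt v y n (F.toℕ<n y) ℕ.≤-refl) ⟩
    vecWord (addUnit v y) n · wordOf π    ≈⟨ normalForm-cong (mk ((λ i → cong (v i +ℤ_) (sym (single-⟨$⟩ˡ π (pt n-1) 1ℤ i))) , (λ _ → refl))) ⟩
    normalForm ((v , π) *SD eval g)       ∎
    where
    y : Fin n
    y = π ⟨$⟩ʳ pt n-1

  normalForm-∙ : ∀ a y → n ⊢ normalForm y · a ≈ normalForm (y *SD eval a)
  normalForm-∙ (gen x) y = normalForm-∙-gen x y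
  normalForm-∙ e y = ≈-trans (idʳ _) (normalForm-cong (SD.sym (SD.identityʳ y)))
  normalForm-∙ (a · b) y = begin
    normalForm y · (a · b)                   ≈⟨ ≈-sym (assoc _ _ _) ⟩
    (normalForm y · a) · b                   ≈⟨ ∙-congʳ (normalForm-∙ a y) ⟩
    normalForm (y *SD eval a) · b            ≈⟨ normalForm-∙ b (y *SD eval a) ⟩
    normalForm ((y *SD eval a) *SD eval b)   ≈⟨ normalForm-cong (SD.assoc y (eval a) (eval b)) ⟩
    normalForm (y *SD eval (a · b))          ∎
  normalForm-∙ (a ⁻¹) y = begin
    normalForm y · a ⁻¹                  ≈⟨ ∙-congʳ (normalForm-cong y≋) ⟩
    normalForm (y' *SD eval a) · a ⁻¹    ≈⟨ ∙-congʳ (≈-sym (normalForm-∙ a y')) ⟩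
    (normalForm y' · a) · a ⁻¹           ≈⟨ assoc _ _ _ ⟩
    normalForm y' · (a · a ⁻¹)           ≈⟨ ∙-congˡ (invʳ a) ⟩
    normalForm y' · e                    ≈⟨ idʳ _ ⟩
    normalForm y'                        ∎
    where
    y' : SD n
    y' = y *SD invSD (eval a)
    y≋ : y ≋ (y' *SD eval a)
    y≋ = SD.sym (SD.trans (SD.assoc y (invSD (eval a)) (eval a))
                  (SD.trans (SD.∙-congˡ {y} (SD.inverseˡ (eval a))) (SD.identityʳ y)))

  normalForm-ε : n ⊢ normalForm εSD ≈ e
  normalForm-ε = ≈-trans (·-cong (vecWord-0 n) wordOf-id) (idʳ e)
    where
    vecWord-0 : ∀ r → n ⊢ vecWord (λ _ → 0ℤ) r ≈ e
    vecWord-0 zero = ≈-refl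
    vecWord-0 (suc r) = ≈-trans (idʳ _) (vecWord-0 r)

  word≈normalForm : ∀ a → n ⊢ a ≈ normalForm (eval a)
  word≈normalForm a = begin
    a                          ≈⟨ ≈-sym (idˡ a) ⟩
    e · a                      ≈⟨ ∙-congʳ (≈-sym normalForm-ε) ⟩
    normalForm εSD · a         ≈⟨ normalForm-∙ a εSD ⟩
    normalForm (εSD *SD eval a) ≈⟨ normalForm-cong (SD.identityˡ (eval a)) ⟩
    normalForm (eval a)        ∎

  eval-injective : ∀ a b → eval a ≈SD eval b → n ⊢ a ≈ b
  eval-injective a b eq = ≈-trans (word≈normalForm a) (≈-trans (normalForm-cong (mk eq)) (≈-sym (word≈normalForm b)))

mainTheorem5 : (n : ℕ) → 4 ≤ n →
    Σ (Word → SD n) λ f →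
      (∀ {a b} → n ⊢ a ≈ b → f a ≈SD f b)
      × (∀ a b → f (a · b) ≈SD (f a *SD f b))
      × (∀ a b → f a ≈SD f b → n ⊢ a ≈ b)
      × (∀ (y : SD n) → ∃ λ a → f a ≈SD y)
mainTheorem5 (suc (suc (suc (suc k)))) (s≤s (s≤s (s≤s (s≤s z≤n)))) =
  eval , (λ a≈b → get (eval-sound a≈b)) , (λ _ _ → (λ _ → refl) , (λ _ → refl)) , eval-injective ,
  (λ y → normalForm y , get (eval-normalForm y))
  where
  open Presentation k
  open SemidirectProduct (4 + k) using (get)
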